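{- Let $F_1$ and $F_2$ be forests with $X_{F_1}^{F_1}=X_{F_2}^{F_2}$. Then $\kappa(F_1)=\kappa(F_2)$, where $\kappa$ denotes the number of connected components, unless one of $F_1,F_2$ is isomorphic to $K_1\sqcup K_2$ and the other to $P_3$.
   Context: All graphs are finite and simple. $K_1\sqcup K_2$ is an isolated vertex plus a disjoint edge; $P_3$ is the path on 3 vertices. A graph homomorphism $G\to H$ is a vertex map sending edges to edges; its type is the partition of nonzero preimage sizes. For a partition $\lambda$ with $r_i(\lambda)$ parts equal to $i$, $m_\lambda^N=\frac{N!}{\binom{N}{r_1(\lambda),r_2(\lambda),\dots,N-\ell(\lambda)}}m_\lambda$ with $m_\lambda$ the monomial symmetric function. The $H$-chromatic symmetric function is $X_G^H=\sum_\lambda d_\lambda m_\lambda^{|V(H)|}$, $d_\lambda$ the number of homomorphisms $G\to H$ of type $\lambda$; $X_G^G$ is the self-chromatic symmetric function. -}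

module Defs where

open import Data.Nat using (ℕ; zero; suc; _∸_; _*_; _≤_; _≟_)
open import Data.Nat.Properties using (≤-decTotalOrder)
open import Data.Nat.Combinatorics using (_C_)
open import Data.Bool using (Bool; true; false)
open import Data.Fin using (Fin) renaming (zero to f0; suc to fs)
import Data.Fin as Fin
open import Data.Fin.Properties using (all?)
open import Data.Vec using (Vec; []; _∷_; lookup)
open import Data.List using (List; []; _∷_; _++_; length; filter; map; upTo; allFin; concatMap)
open import Data.Nat.ListAction using (sum)
open import Data.List.Relation.Unary.Linked using (Linked)
open import Data.List.Relation.Unary.Unique.Propositional using (Unique)
open import Data.List.Sort.MergeSort ≤-decTotalOrder using (sort)
open import Data.Product using (Σ; ∃; _×_; _,_)
open import Function.Bundles using (_↔_; Inverse)
open import Relation.Binary.PropositionalEquality using (_≡_)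
open import Relation.Nullary using (Dec; ¬_)
open import Relation.Nullary.Decidable using (_→-dec_; ¬?)
open import Data.Bool.Properties using () renaming (_≟_ to _≟ᵇ_)

record Graph : Set where
  field
    n     : ℕ
    adj   : Fin n → Fin n → Bool
    sym   : ∀ u v → adj u v ≡ adj v u
    irrefl : ∀ v → adj v v ≡ false
open Graph public

E : (G : Graph) → Fin (n G) → Fin (n G) → Set
E G u v = adj G u v ≡ true

E? : (G : Graph) → ∀ u v → Dec (E G u v)
E? G u v = adj G u v ≟ᵇ true

data Walk (G : Graph) : Fin (n G) → Fin (n G) → Set where
  here : ∀ {v} → Walk G v v
  step : ∀ {u w v} → E G u w → Walk G w v → Walk G u v

Reach : (G : Graph) → Fin (n G) → Fin (n G) → Set
Reach G u v = Walk G u v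

HasComponents : Graph → ℕ → Set
HasComponents G k =
  Σ (Fin (n G) → Fin k) λ c →
    (∀ (i : Fin k) → ∃ λ v → c v ≡ i) ×
    (∀ u v → (c u ≡ c v → Reach G u v) × (Reach G u v → c u ≡ c v))

IsCycle : (G : Graph) → List (Fin (n G)) → Set
IsCycle G [] = Data.Empty.⊥
  where import Data.Empty
IsCycle G (v ∷ ws) = (2 ≤ length ws) × Unique (v ∷ ws) × Linked (E G) (v ∷ ws ++ v ∷ [])

Forest : Graph → Set
Forest G = ∀ (vs : List (Fin (n G))) → ¬ IsCycle G vs

_≅_ : Graph → Graph → Set
G ≅ H = Σ (Fin (n G) ↔ Fin (n H)) λ f →
  ∀ u v → adj G u v ≡ adj H (Inverse.to f u) (Inverse.to f v)

K1⊔K2 : Graph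
K1⊔K2 = record { n = 3 ; adj = a ; sym = s ; irrefl = i }
  where
  a : Fin 3 → Fin 3 → Bool
  a (fs f0) (fs (fs f0)) = true
  a (fs (fs f0)) (fs f0) = true
  a _ _ = false
  s : ∀ u v → a u v ≡ a v u
  s f0 f0 = Relation.Binary.PropositionalEquality.refl
  s f0 (fs f0) = Relation.Binary.PropositionalEquality.refl
  s f0 (fs (fs f0)) = Relation.Binary.PropositionalEquality.refl
  s (fs f0) f0 = Relation.Binary.PropositionalEquality.refl
  s (fs f0) (fs f0) = Relation.Binary.PropositionalEquality.refl
  s (fs f0) (fs (fs f0)) = Relation.Binary.PropositionalEquality.refl
  s (fs (fs f0)) f0 = Relation.Binary.PropositionalEquality.refl
  s (fs (fs f0)) (fs f0) = Relation.Binary.PropositionalEquality.refl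
  s (fs (fs f0)) (fs (fs f0)) = Relation.Binary.PropositionalEquality.refl
  i : ∀ v → a v v ≡ false
  i f0 = Relation.Binary.PropositionalEquality.refl
  i (fs f0) = Relation.Binary.PropositionalEquality.refl
  i (fs (fs f0)) = Relation.Binary.PropositionalEquality.refl

P3 : Graph
P3 = record { n = 3 ; adj = a ; sym = s ; irrefl = i }
  where
  a : Fin 3 → Fin 3 → Bool
  a f0 (fs f0) = true
  a (fs f0) f0 = true
  a (fs f0) (fs (fs f0)) = true
  a (fs (fs f0)) (fs f0) = true
  a _ _ = false
  s : ∀ u v → a u v ≡ a v u
  s f0 f0 = Relation.Binary.PropositionalEquality.refl
  s f0 (fs f0) = Relation.Binary.PropositionalEquality.refl
  s f0 (fs (fs f0)) = Relation.Binary.PropositionalEquality.refl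
  s (fs f0) f0 = Relation.Binary.PropositionalEquality.refl
  s (fs f0) (fs f0) = Relation.Binary.PropositionalEquality.refl
  s (fs f0) (fs (fs f0)) = Relation.Binary.PropositionalEquality.refl
  s (fs (fs f0)) f0 = Relation.Binary.PropositionalEquality.refl
  s (fs (fs f0)) (fs f0) = Relation.Binary.PropositionalEquality.refl
  s (fs (fs f0)) (fs (fs f0)) = Relation.Binary.PropositionalEquality.refl
  i : ∀ v → a v v ≡ false
  i f0 = Relation.Binary.PropositionalEquality.refl
  i (fs f0) = Relation.Binary.PropositionalEquality.refl
  i (fs (fs f0)) = Relation.Binary.PropositionalEquality.refl

-- vertex maps Fin a → Fin b, represented as vectors (f = lookup v)
allMaps : (a b : ℕ) → List (Vec (Fin b) a)
allMaps zero b = [] ∷ []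
allMaps (suc a) b = concatMap (λ x → map (x ∷_) (allMaps a b)) (allFin b)

IsHom : (G H : Graph) → Vec (Fin (n H)) (n G) → Set
IsHom G H f = ∀ u v → E G u v → E H (lookup f u) (lookup f v)

IsHom? : (G H : Graph) → ∀ f → Dec (IsHom G H f)
IsHom? G H f = all? λ u → all? λ v → E? G u v →-dec E? H (lookup f u) (lookup f v)

fiber : ∀ {a b} → Vec (Fin b) a → Fin b → ℕ
fiber {a} f w = length (filter (λ u → lookup f u Fin.≟ w) (allFin a))

-- type of f : the partition of nonzero preimage sizes, as a list of
-- parts in (weakly) increasing order
homType : ∀ {a b} → Vec (Fin b) a → List ℕ
homType {a} {b} f = sort (filter (λ k → ¬? (k ≟ 0)) (map (fiber f) (allFin b)))

d : (G H : Graph) → List ℕ → ℕ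
d G H λ' = length (filter (λ f → IsHom? G H f Relation.Nullary.Decidable.×-dec
                                  Data.List.Properties.≡-dec _≟_ (homType f) λ')
                          (allMaps (n G) (n H)))
  where import Data.List.Properties

-- The symmetric function X_G^H, given by its coefficients in the
-- monomial basis m_λ.

mult : List ℕ → ℕ → ℕ
mult λ' i = length (filter (λ j → j ≟ i) λ')

-- multinomial N!/(r₁! r₂! ⋯ (N - Σ rᵢ)!) = C(N,r₁)·C(N-r₁,r₂)·⋯
multinomial : ℕ → List ℕ → ℕ
multinomial N [] = 1
multinomial N (r ∷ rs) = (N C r) * multinomial (N ∸ r) rs

-- m_λ^N = multinomial N (r₁(λ), r₂(λ), …) · m_λ
mCoeff : ℕ → List ℕ → ℕ
mCoeff N λ' = multinomial N (map (λ i → mult λ' (suc i)) (upTo (sum λ')))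

-- coefficient of m_λ in X_G^H = Σ_λ d_λ m_λ^{|V(H)|}
X : (G H : Graph) → List ℕ → ℕ
X G H λ' = d G H λ' * mCoeff (n H) λ'

_≡Sym_ : (List ℕ → ℕ) → (List ℕ → ℕ) → Set
p ≡Sym q = ∀ λ' → p λ' ≡ q λ'

{-# OPTIONS --safe #-}

-- Root every component of a forest F with n vertices and k components; the non-roots w then correspond to
-- the n − k edges {w, parent w}. F has a self-homomorphism with a one-vertex image iff it has no edge, and the
-- self-homomorphisms with a two-vertex image are the maps onto a single edge {w, parent w} that send, in each
-- component independently, all vertices of even depth to the same end: there are (n − k)·2^k of them. The
-- monomial coefficients of X_F^F are positive multiples of the numbers d_λ, so X_F^F determines n and both
-- counts. For forests with a = n − k₁ > 0 and b = n − k₂ > 0 edges, a + k₁ = b + k₂ and a·2^k₁ = b·2^k₂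
-- force k₁ = k₂ unless {a, b} = {1, 2}. Then one forest is an edge plus isolated vertices, with 2n^(n−2)
-- self-homomorphisms, and the other is P₃ or two disjoint edges plus isolated vertices, with 6n^(n−3) or
-- 16n^(n−4) of them; equality forces n = 3, so the forests are K₁ ⊔ K₂ and P₃.

module Submission where

open import Data.Bool using (Bool; true; false; not; _xor_; T; T?)
open import Data.Bool.Properties
  using (not-involutive; ¬-not; xor-assoc; xor-same; xor-identityʳ; not-distribˡ-xor; not-distribʳ-xor)
open import Data.Empty using (⊥; ⊥-elim)
open import Data.Fin as Fin using (Fin)
import Data.Fin.Properties as Finₚ
open import Data.List using (List; []; _∷_; _++_; _ʳ++_; length; filter; map; concatMap; cartesianProduct; allFin; upTo; deduplicate)
open import Data.List.Membership.Propositional using (_∈_; _∉_; find)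
open import Data.List.Membership.Propositional.Properties
  using ( ∈-∃++; ∈-++⁺ˡ; ∈-++⁺ʳ; ∈-++⁻; ∈-map⁺; ∈-map⁻; ∈-concatMap⁺; ∈-concatMap⁻; ∈-allFin
        ; ∈-cartesianProduct⁺; ∈-cartesianProduct⁻; ∈-filter⁺; ∈-filter⁻; ∈-deduplicate⁺; ∈-deduplicate⁻)
open import Data.List.Properties as List using (length-++; length-map; length-tabulate; filter-all; filter-none; filter-++)
open import Data.List.Relation.Binary.Permutation.Propositional.Properties using (↭-length)
open import Data.List.Relation.Unary.All as All using (All; []; _∷_)
import Data.List.Relation.Unary.All.Properties as AllP
open import Data.List.Relation.Unary.AllPairs using ([]; _∷_)
open import Data.List.Relation.Unary.Any as Any using (here; there)
open import Data.List.Relation.Unary.Linked using (Linked; []; [-]; _∷_)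
open import Data.List.Relation.Unary.Unique.DecPropositional.Properties using (deduplicate-!)
open import Data.List.Relation.Unary.Unique.Propositional using (Unique)
import Data.List.Relation.Unary.Unique.Propositional.Properties as Unique
open import Data.Maybe as Maybe using (Maybe; just; nothing)
open import Data.Nat using (ℕ; zero; suc; _+_; _*_; _∸_; _^_; _≤_; _<_; z≤n; s≤s; _≟_; >-nonZero)
open import Data.Nat.Combinatorics using (_C_; nCk+nC[k+1]≡[n+1]C[k+1])
open import Data.Nat.ListAction using (sum)
open import Data.Nat.ListAction.Properties using (sum-↭)
open import Data.Nat.Properties
  using ( ≤-decTotalOrder; ≤-refl; ≤-trans; ≤-reflexive; ≤-antisym; <-irrefl; <-cmp; <⇒≤; n>0⇒n≢0; n≢0⇒n>0
        ; +-identityʳ; +-suc; +-comm; +-assoc; +-mono-≤; +-cancelˡ-≤; +-cancelˡ-≡; m≤m+n; m≤n+m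
        ; *-zeroʳ; *-identityʳ; *-suc; *-comm; *-assoc; *-distribˡ-+; *-distribʳ-+; *-monoʳ-≤; *-mono-≤; *-cancelʳ-≤; *-cancelʳ-≡
        ; m+n∸m≡n; m+n∸n≡m; m∸n+n≡m; m+[n∸m]≡n; ∸-monoˡ-≤; m<n⇒0<n∸m; ^-distribˡ-+-*; m^n>0; suc-injective
        ; +-commutativeSemigroup; *-commutativeSemigroup; module ≤-Reasoning)
open import Algebra.Properties.CommutativeSemigroup +-commutativeSemigroup using () renaming (interchange to +-interchange)
open import Algebra.Properties.CommutativeSemigroup *-commutativeSemigroup using () renaming (x∙yz≈y∙xz to *-exchange)
open import Data.List.Sort.MergeSort.Properties ≤-decTotalOrder using (sort-↭)
open import Data.Product as Product using (Σ; ∃; _×_; _,_; proj₁; proj₂)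
open import Data.Product.Properties using () renaming (≡-dec to ×-≡-dec)
open import Data.Sum as Sum using (_⊎_; inj₁; inj₂; [_,_])
open import Data.Unit using (⊤; tt)
open import Data.Vec using (Vec; []; _∷_; lookup; tabulate; replicate)
open import Data.Vec.Properties using (lookup-replicate; lookup∘tabulate; tabulate∘lookup; tabulate-cong; ∷-injectiveʳ)
open import Function using (_∘_; id)
open import Function.Bundles using (mk↔ₛ′)
open import Level using (0ℓ)
open import Relation.Binary.Definitions using (DecidableEquality; tri<; tri≈; tri>)
open import Relation.Binary.PropositionalEquality
  using (_≡_; _≢_; refl; sym; trans; cong; cong₂; subst; subst₂; ≢-sym; module ≡-Reasoning)
open import Relation.Nullary using (Dec; yes; no; does; ¬_; ¬?)
open import Relation.Nullary.Decidable using (_×-dec_)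
open import Relation.Unary using (Pred; Decidable)
open import Defs hiding (sym)

count : {A : Set} {P : Pred A 0ℓ} → Decidable P → List A → ℕ
count P? xs = length (filter P? xs)

indicator : {P : Set} → Dec P → ℕ
indicator (yes _) = 1
indicator (no _) = 0

sumBy : {A : Set} → (A → ℕ) → List A → ℕ
sumBy h [] = 0
sumBy h (x ∷ xs) = h x + sumBy h xs

syntax sumBy (λ x → h) xs = ∑[ x ∈ xs ] h

module _ {A : Set} where

  count-∷ : {P : Pred A 0ℓ} (P? : Decidable P) (x : A) (xs : List A) →
    count P? (x ∷ xs) ≡ indicator (P? x) + count P? xs
  count-∷ P? x xs with P? x
  ... | yes _ = refl
  ... | no _ = refl

  count-≐ : {P Q : Pred A 0ℓ} (P? : Decidable P) (Q? : Decidable Q) →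
    (∀ {x} → P x → Q x) → (∀ {x} → Q x → P x) → ∀ xs → count P? xs ≡ count Q? xs
  count-≐ P? Q? P⇒Q Q⇒P xs = cong length (List.filter-≐ P? Q? (P⇒Q , Q⇒P) xs)

  count-all : {P : Pred A 0ℓ} (P? : Decidable P) → (∀ x → P x) → ∀ xs → count P? xs ≡ length xs
  count-all P? all xs = cong length (filter-all P? (All.universal all xs))

  count-none : {P : Pred A 0ℓ} (P? : Decidable P) (xs : List A) → (∀ {x} → x ∈ xs → ¬ P x) → count P? xs ≡ 0
  count-none P? xs none = cong length (filter-none P? (All.tabulate none))

  count-++ : {P : Pred A 0ℓ} (P? : Decidable P) (xs ys : List A) → count P? (xs ++ ys) ≡ count P? xs + count P? ys
  count-++ P? xs ys = trans (cong length (filter-++ P? xs ys)) (length-++ (filter P? xs))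

  count+count-¬ : {P : Pred A 0ℓ} (P? : Decidable P) (xs : List A) → count P? xs + count (¬? ∘ P?) xs ≡ length xs
  count+count-¬ P? [] = refl
  count+count-¬ P? (x ∷ xs) with P? x
  ... | yes _ = cong suc (count+count-¬ P? xs)
  ... | no _ = trans (+-suc _ _) (cong suc (count+count-¬ P? xs))

  count-const×-dec : {S : Set} {Q : Pred A 0ℓ} (S? : Dec S) (Q? : Decidable Q) (xs : List A) →
    count (λ x → S? ×-dec Q? x) xs ≡ indicator S? * count Q? xs
  count-const×-dec (yes s) Q? xs = trans (count-≐ _ Q? proj₂ (s ,_) xs) (sym (+-identityʳ _))
  count-const×-dec (no ¬s) Q? xs = count-none _ xs (λ _ → ¬s ∘ proj₁)

  count-filter : {P Q : Pred A 0ℓ} (P? : Decidable P) (Q? : Decidable Q) (xs : List A) →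
    count Q? (filter P? xs) ≡ count (λ x → P? x ×-dec Q? x) xs
  count-filter P? Q? [] = refl
  count-filter P? Q? (x ∷ xs) with P? x
  ... | no _ = count-filter P? Q? xs
  ... | yes _ with Q? x
  ...   | yes _ = cong suc (count-filter P? Q? xs)
  ...   | no _ = count-filter P? Q? xs

  count>0⇒∈ : {P : Pred A 0ℓ} (P? : Decidable P) (xs : List A) → 0 < count P? xs → ∃ λ x → x ∈ xs × P x
  count>0⇒∈ P? xs pos with filter P? xs in eq
  count>0⇒∈ P? xs () | []
  ... | x ∷ _ = x , ∈-filter⁻ P? (subst (x ∈_) (sym eq) (here refl))

  ∈⇒count>0 : {P : Pred A 0ℓ} (P? : Decidable P) {x : A} {xs : List A} → x ∈ xs → P x → 0 < count P? xs
  ∈⇒count>0 P? x∈xs px = List.filter-some P? (Any.map (λ { refl → px }) x∈xs)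

  ∑-cong : {h₁ h₂ : A → ℕ} (xs : List A) → (∀ {x} → x ∈ xs → h₁ x ≡ h₂ x) → ∑[ x ∈ xs ] h₁ x ≡ ∑[ x ∈ xs ] h₂ x
  ∑-cong [] eq = refl
  ∑-cong (x ∷ xs) eq = cong₂ _+_ (eq (here refl)) (∑-cong xs (eq ∘ there))

  ∑-zero : {h : A → ℕ} (xs : List A) → (∀ {x} → x ∈ xs → h x ≡ 0) → ∑[ x ∈ xs ] h x ≡ 0
  ∑-zero [] eq = refl
  ∑-zero (x ∷ xs) eq rewrite eq (here refl) = ∑-zero xs (eq ∘ there)

  ∑-+ : (h₁ h₂ : A → ℕ) (xs : List A) → ∑[ x ∈ xs ] (h₁ x + h₂ x) ≡ ∑[ x ∈ xs ] h₁ x + ∑[ x ∈ xs ] h₂ x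
  ∑-+ h₁ h₂ [] = refl
  ∑-+ h₁ h₂ (x ∷ xs) =
    trans (cong ((h₁ x + h₂ x) +_) (∑-+ h₁ h₂ xs)) (+-interchange (h₁ x) (h₂ x) (sumBy h₁ xs) (sumBy h₂ xs))

  ∑-*ʳ : (h : A → ℕ) (xs : List A) (m : ℕ) → (∑[ x ∈ xs ] h x) * m ≡ ∑[ x ∈ xs ] (h x * m)
  ∑-*ʳ h [] m = refl
  ∑-*ʳ h (x ∷ xs) m = trans (*-distribʳ-+ m (h x) (sumBy h xs)) (cong (h x * m +_) (∑-*ʳ h xs m))

  ∑-const : (m : ℕ) (xs : List A) → ∑[ x ∈ xs ] m ≡ length xs * m
  ∑-const m [] = refl
  ∑-const m (x ∷ xs) = cong (m +_) (∑-const m xs)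

  ∑-indicator : {P : Pred A 0ℓ} (P? : Decidable P) (xs : List A) → ∑[ x ∈ xs ] indicator (P? x) ≡ count P? xs
  ∑-indicator P? [] = refl
  ∑-indicator P? (x ∷ xs) = trans (cong (indicator (P? x) +_) (∑-indicator P? xs)) (sym (count-∷ P? x xs))

  ∑-select : (_≟A_ : DecidableEquality A) (c : A → ℕ) {xs : List A} → Unique xs →
    ∀ {y} → y ∈ xs → ∑[ x ∈ xs ] (c x * indicator (y ≟A x)) ≡ c y
  ∑-select _≟A_ c {x ∷ xs} (x∉xs ∷ uxs) {y} (here refl) with y ≟A y
  ... | no y≢y = ⊥-elim (y≢y refl)
  ... | yes _ = trans (cong₂ _+_ (*-identityʳ (c y)) (∑-zero xs vanish)) (+-identityʳ (c y))
    where
    vanish : ∀ {z} → z ∈ xs → c z * indicator (y ≟A z) ≡ 0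
    vanish {z} z∈xs with y ≟A z
    ... | yes refl = ⊥-elim (All.lookup x∉xs z∈xs refl)
    ... | no _ = *-zeroʳ (c z)
  ∑-select _≟A_ c {x ∷ xs} (x∉xs ∷ uxs) {y} (there y∈xs) with y ≟A x
  ... | yes refl = ⊥-elim (All.lookup x∉xs y∈xs refl)
  ... | no _ = trans (cong (_+ ∑[ z ∈ xs ] (c z * indicator (y ≟A z))) (*-zeroʳ (c x))) (∑-select _≟A_ c uxs y∈xs)

  unique-length-≤ : {xs ys : List A} → Unique xs → (∀ {z} → z ∈ xs → z ∈ ys) → length xs ≤ length ys
  unique-length-≤ {[]} _ _ = z≤n
  unique-length-≤ {x ∷ xs} {ys} (x∉xs ∷ uxs) xs⊆ys with ∈-∃++ (xs⊆ys (here refl))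
  ... | as , bs , refl = ≤-trans (s≤s (unique-length-≤ uxs xs⊆as++bs)) (≤-reflexive (sym length-as++x∷bs))
    where
    xs⊆as++bs : ∀ {z} → z ∈ xs → z ∈ as ++ bs
    xs⊆as++bs z∈xs with ∈-++⁻ as (xs⊆ys (there z∈xs))
    ... | inj₁ z∈as = ∈-++⁺ˡ z∈as
    ... | inj₂ (here refl) = ⊥-elim (All.lookup x∉xs z∈xs refl)
    ... | inj₂ (there z∈bs) = ∈-++⁺ʳ as z∈bs
    length-as++x∷bs : length (as ++ x ∷ bs) ≡ suc (length (as ++ bs))
    length-as++x∷bs = trans (length-++ as) (trans (+-suc (length as) (length bs)) (cong suc (sym (length-++ as))))

  unique-length-≡ : {xs ys : List A} → Unique xs → Unique ys →
    (∀ {z} → z ∈ xs → z ∈ ys) → (∀ {z} → z ∈ ys → z ∈ xs) → length xs ≡ length ys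
  unique-length-≡ uxs uys xs⊆ys ys⊆xs = ≤-antisym (unique-length-≤ uxs xs⊆ys) (unique-length-≤ uys ys⊆xs)

  map-unique-on : {B : Set} (g : A → B) {xs : List A} → Unique xs →
    (∀ {x y} → x ∈ xs → y ∈ xs → g x ≡ g y → x ≡ y) → Unique (map g xs)
  map-unique-on g {[]} _ _ = []
  map-unique-on g {x ∷ xs} (x∉xs ∷ uxs) inj =
    All.tabulate gx∉ ∷ map-unique-on g uxs (λ x∈ y∈ → inj (there x∈) (there y∈))
    where
    gx∉ : ∀ {y} → y ∈ map g xs → g x ≢ y
    gx∉ y∈ gx≡y with ∈-map⁻ g y∈
    ... | z , z∈xs , refl = All.lookup x∉xs z∈xs (inj (here refl) (there z∈xs) gx≡y)

  unique-concatMap : {B : Set} (g : A → List B) (tag : B → A) {xs : List A} → Unique xs →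
    (∀ x → Unique (g x)) → (∀ {x y} → y ∈ g x → tag y ≡ x) → Unique (concatMap g xs)
  unique-concatMap g tag {[]} _ _ _ = []
  unique-concatMap g tag {x ∷ xs} (x∉xs ∷ uxs) ug tagged =
    Unique.++⁺ (ug x) (unique-concatMap g tag uxs ug tagged) disjoint
    where
    disjoint : ∀ {y} → ¬ (y ∈ g x × y ∈ concatMap g xs)
    disjoint (y∈gx , y∈rest) with find (∈-concatMap⁻ g {xs = xs} y∈rest)
    ... | x′ , x′∈xs , y∈gx′ = All.lookup x∉xs x′∈xs (trans (sym (tagged y∈gx)) (tagged y∈gx′))

module _ {A : Set} where

  count-map : {B : Set} {P : Pred B 0ℓ} (P? : Decidable P) (g : A → B) (xs : List A) →
    count P? (map g xs) ≡ count (P? ∘ g) xs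
  count-map P? g [] = refl
  count-map P? g (x ∷ xs) with P? (g x)
  ... | yes _ = cong suc (count-map P? g xs)
  ... | no _ = count-map P? g xs

  length-concatMap-map : {B C : Set} (t : A → C → B) (xs : List A) (ys : List C) →
    length (concatMap (λ x → map (t x) ys) xs) ≡ length xs * length ys
  length-concatMap-map t [] ys = refl
  length-concatMap-map t (x ∷ xs) ys =
    trans (length-++ (map (t x) ys)) (cong₂ _+_ (length-map (t x) ys) (length-concatMap-map t xs ys))

  count-concatMap : {B : Set} {P : Pred B 0ℓ} (P? : Decidable P) (g : A → List B) (xs : List A) →
    count P? (concatMap g xs) ≡ ∑[ x ∈ xs ] count P? (g x)
  count-concatMap P? g [] = refl
  count-concatMap P? g (x ∷ xs) =
    trans (count-++ P? (g x) (concatMap g xs)) (cong (count P? (g x) +_) (count-concatMap P? g xs))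

  count-by-value : {B : Set} (_≟B_ : DecidableEquality B) (g : A → B) {Q : Pred B 0ℓ} (Q? : Decidable Q)
    {ys : List B} → Unique ys → (xs : List A) → (∀ {x} → x ∈ xs → g x ∈ ys) →
    count (Q? ∘ g) xs ≡ ∑[ y ∈ ys ] (indicator (Q? y) * count (λ x → g x ≟B y) xs)
  count-by-value _≟B_ g Q? {ys} uys [] _ = sym (∑-zero ys (λ {y} _ → *-zeroʳ (indicator (Q? y))))
  count-by-value _≟B_ g Q? {ys} uys (x ∷ xs) covers = begin
    count (Q? ∘ g) (x ∷ xs)
      ≡⟨ count-∷ (Q? ∘ g) x xs ⟩
    indicator (Q? (g x)) + count (Q? ∘ g) xs
      ≡⟨ cong₂ _+_ (sym (∑-select _≟B_ (indicator ∘ Q?) uys (covers (here refl))))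
                   (count-by-value _≟B_ g Q? uys xs (covers ∘ there)) ⟩
    ∑[ y ∈ ys ] (indicator (Q? y) * indicator (g x ≟B y)) + ∑[ y ∈ ys ] (indicator (Q? y) * count (λ z → g z ≟B y) xs)
      ≡⟨ ∑-+ _ _ ys ⟨
    ∑[ y ∈ ys ] (indicator (Q? y) * indicator (g x ≟B y) + indicator (Q? y) * count (λ z → g z ≟B y) xs)
      ≡⟨ ∑-cong ys (λ {y} _ → trans (sym (*-distribˡ-+ (indicator (Q? y)) _ _))
                                    (cong (indicator (Q? y) *_) (sym (count-∷ (λ z → g z ≟B y) x xs)))) ⟩
    ∑[ y ∈ ys ] (indicator (Q? y) * count (λ z → g z ≟B y) (x ∷ xs))
      ∎
    where open ≡-Reasoning

length-cartesianProduct : {A B : Set} (xs : List A) (ys : List B) → length (cartesianProduct xs ys) ≡ length xs * length ys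
length-cartesianProduct [] ys = refl
length-cartesianProduct (x ∷ xs) ys =
  trans (length-++ (map (x ,_) ys)) (cong₂ _+_ (length-map (x ,_) ys) (length-cartesianProduct xs ys))

count-cartesianProduct : {A B : Set} {R : Pred A 0ℓ} {S : Pred B 0ℓ} (R? : Decidable R) (S? : Decidable S) (xs : List A) (ys : List B) →
  count (λ p → R? (proj₁ p) ×-dec S? (proj₂ p)) (cartesianProduct xs ys) ≡ count R? xs * count S? ys
count-cartesianProduct R? S? [] ys = refl
count-cartesianProduct R? S? (x ∷ xs) ys = begin
  count RS? (map (x ,_) ys ++ cartesianProduct xs ys)              ≡⟨ count-++ RS? (map (x ,_) ys) _ ⟩
  count RS? (map (x ,_) ys) + count RS? (cartesianProduct xs ys)    ≡⟨ cong₂ _+_ (trans (count-map RS? (x ,_) ys) (count-const×-dec (R? x) S? ys))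
                                                                                 (count-cartesianProduct R? S? xs ys) ⟩
  indicator (R? x) * count S? ys + count R? xs * count S? ys        ≡⟨ *-distribʳ-+ (count S? ys) (indicator (R? x)) _ ⟨
  (indicator (R? x) + count R? xs) * count S? ys                    ≡⟨ cong (_* count S? ys) (count-∷ R? x xs) ⟨
  count R? (x ∷ xs) * count S? ys                                   ∎
  where
  open ≡-Reasoning
  RS? = λ p → R? (proj₁ p) ×-dec S? (proj₂ p)

count-≡-length : {A : Set} {R : Pred A 0ℓ} (R? : Decidable R) {xs es : List A} → Unique xs → (∀ t → t ∈ xs) →
  Unique es → (∀ {t} → R t → t ∈ es) → (∀ {t} → t ∈ es → R t) → count R? xs ≡ length es
count-≡-length R? {xs} uxs complete ues R⇒∈ ∈⇒R =
  unique-length-≡ (Unique.filter⁺ R? uxs) ues (λ t∈ → R⇒∈ (proj₂ (∈-filter⁻ R? {xs = xs} t∈))) (λ t∈ → ∈-filter⁺ R? (complete _) (∈⇒R t∈))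

sum-map : {A : Set} (h : A → ℕ) (xs : List A) → sum (map h xs) ≡ ∑[ x ∈ xs ] h x
sum-map h [] = refl
sum-map h (x ∷ xs) = cong (h x +_) (sum-map h xs)

unique-++⁻ˡ : {A : Set} (as : List A) {bs : List A} → Unique (as ++ bs) → Unique as
unique-++⁻ˡ [] _ = []
unique-++⁻ˡ (a ∷ as) (a∉ ∷ u) = AllP.++⁻ˡ as a∉ ∷ unique-++⁻ˡ as u

unique-∉-prefix : {A : Set} (as : List A) {x : A} {bs : List A} → Unique (as ++ x ∷ bs) → x ∉ as
unique-∉-prefix (a ∷ as) (a∉ ∷ _) (here refl) = All.lookup a∉ (∈-++⁺ʳ as (here refl)) refl
unique-∉-prefix (a ∷ as) (_ ∷ u) (there x∈) = unique-∉-prefix as u x∈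

linked-prefix : {A : Set} {R : A → A → Set} (as : List A) {b : A} {bs : List A} → Linked R (as ++ b ∷ bs) → Linked R (as ++ b ∷ [])
linked-prefix [] {bs = []} l = l
linked-prefix [] {bs = _ ∷ _} l = [-]
linked-prefix (a ∷ []) (r ∷ l) = r ∷ [-]
linked-prefix (a ∷ a′ ∷ as) (r ∷ l) = r ∷ linked-prefix (a′ ∷ as) l

length-allFin : ∀ m → length (allFin m) ≡ m
length-allFin m = length-tabulate id

lookup-ext : {A : Set} {m : ℕ} {s t : Vec A m} → (∀ i → lookup s i ≡ lookup t i) → s ≡ t
lookup-ext {s = s} {t} eq = trans (sym (tabulate∘lookup s)) (trans (tabulate-cong eq) (tabulate∘lookup t))

allMaps-complete : ∀ a b (f : Vec (Fin b) a) → f ∈ allMaps a b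
allMaps-complete zero b [] = here refl
allMaps-complete (suc a) b (x ∷ f) =
  ∈-concatMap⁺ (λ y → map (y ∷_) (allMaps a b)) (Any.map (λ { refl → ∈-map⁺ (x ∷_) (allMaps-complete a b f) }) (∈-allFin x))

allMaps-unique : ∀ a b → Unique (allMaps a b)
allMaps-unique zero b = [] ∷ []
allMaps-unique (suc a) b =
  unique-concatMap (λ x → map (x ∷_) (allMaps a b)) head (Unique.allFin⁺ b) (λ x → Unique.map⁺ ∷-injectiveʳ (allMaps-unique a b)) head≡
  where
  head : Vec (Fin b) (suc a) → Fin b
  head (x ∷ _) = x
  head≡ : ∀ {x f} → f ∈ map (x ∷_) (allMaps a b) → head f ≡ x
  head≡ f∈ with ∈-map⁻ _ f∈
  ... | _ , _ , refl = refl

length-allMaps : ∀ a b → length (allMaps a b) ≡ b ^ a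
length-allMaps zero b = refl
length-allMaps (suc a) b =
  trans (length-concatMap-map _∷_ (allFin b) (allMaps a b)) (cong₂ _*_ (length-allFin b) (length-allMaps a b))

module _ {a b : ℕ} (f : Vec (Fin b) a) where

  InImage : Fin b → Set
  InImage z = ∃ λ u → lookup f u ≡ z

  image : List (Fin b)
  image = filter (λ z → ¬? (fiber f z ≟ 0)) (allFin b)

  length-homType : length (homType f) ≡ length image
  length-homType = trans (↭-length (sort-↭ (filter (λ m → ¬? (m ≟ 0)) (map (fiber f) (allFin b)))))
                         (count-map (λ m → ¬? (m ≟ 0)) (fiber f) (allFin b))

  length-homType-≤ : length (homType f) ≤ b
  length-homType-≤ = ≤-trans (≤-reflexive length-homType)
    (≤-trans (List.length-filter (λ z → ¬? (fiber f z ≟ 0)) (allFin b)) (≤-reflexive (length-allFin b)))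

  ∈-image⁺ : ∀ {z} → InImage z → z ∈ image
  ∈-image⁺ {z} (u , fu≡z) = ∈-filter⁺ (λ z → ¬? (fiber f z ≟ 0)) (∈-allFin z)
    (n>0⇒n≢0 (∈⇒count>0 (λ u → lookup f u Fin.≟ z) (∈-allFin u) fu≡z))

  ∈-image⁻ : ∀ {z} → z ∈ image → InImage z
  ∈-image⁻ {z} z∈ with count>0⇒∈ (λ u → lookup f u Fin.≟ z) (allFin a)
                         (n≢0⇒n>0 (proj₂ (∈-filter⁻ (λ z → ¬? (fiber f z ≟ 0)) {xs = allFin b} z∈)))
  ... | u , _ , fu≡z = u , fu≡z

  length-homType-≡ : {zs : List (Fin b)} → Unique zs →
    (∀ {z} → InImage z → z ∈ zs) → (∀ {z} → z ∈ zs → InImage z) → length (homType f) ≡ length zs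
  length-homType-≡ uzs image⊆zs zs⊆image = trans length-homType
    (unique-length-≡ (Unique.filter⁺ (λ z → ¬? (fiber f z ≟ 0)) (Unique.allFin⁺ b)) uzs
                     (image⊆zs ∘ ∈-image⁻) (∈-image⁺ ∘ zs⊆image))

  imageSize≡1⇒ : length (homType f) ≡ 1 → Σ (Fin b) λ x → ∀ {z} → InImage z → z ≡ x
  imageSize≡1⇒ size≡1 = from-image image refl (trans (sym length-homType) size≡1)
    where
    from-image : ∀ zs → zs ≡ image → length zs ≡ 1 → Σ (Fin b) λ x → ∀ {z} → InImage z → z ≡ x
    from-image (x ∷ []) zs≡ _ = x , λ i → only (subst (_ ∈_) (sym zs≡) (∈-image⁺ i))
      where
      only : ∀ {z} → z ∈ x ∷ [] → z ≡ x
      only (here z≡x) = z≡x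

  imageSize≡2⇒ : length (homType f) ≡ 2 →
    Σ (Fin b) λ x → Σ (Fin b) λ y → x ≢ y × (∀ {z} → InImage z → z ≡ x ⊎ z ≡ y)
  imageSize≡2⇒ size≡2 =
    from-image image refl (Unique.filter⁺ (λ z → ¬? (fiber f z ≟ 0)) (Unique.allFin⁺ b)) (trans (sym length-homType) size≡2)
    where
    from-image : ∀ zs → zs ≡ image → Unique zs → length zs ≡ 2 →
      Σ (Fin b) λ x → Σ (Fin b) λ y → x ≢ y × (∀ {z} → InImage z → z ≡ x ⊎ z ≡ y)
    from-image (x ∷ y ∷ []) zs≡ ((x≢y ∷ []) ∷ _) _ = x , y , x≢y , λ i → only (subst (_ ∈_) (sym zs≡) (∈-image⁺ i))
      where
      only : ∀ {z} → z ∈ x ∷ y ∷ [] → z ≡ x ⊎ z ≡ y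
      only (here z≡x) = inj₁ z≡x
      only (there (here z≡y)) = inj₂ z≡y

  sum-homType : sum (homType f) ≡ a
  sum-homType = begin
    sum (homType f)                                  ≡⟨ sum-↭ (sort-↭ (filter (λ m → ¬? (m ≟ 0)) fibers)) ⟩
    sum (filter (λ m → ¬? (m ≟ 0)) fibers)            ≡⟨ sum-filter-nonzero fibers ⟩
    sum fibers                                       ≡⟨ sum-map (fiber f) (allFin b) ⟩
    ∑[ z ∈ allFin b ] fiber f z                      ≡⟨ ∑-cong (allFin b) (λ _ → sym (+-identityʳ _)) ⟩
    ∑[ z ∈ allFin b ] (1 * fiber f z)                ≡⟨ count-by-value Fin._≟_ (lookup f) (λ _ → yes tt) (Unique.allFin⁺ b)
                                                          (allFin a) (λ {u} _ → ∈-allFin (lookup f u)) ⟨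
    count (λ _ → yes tt) (allFin a)                  ≡⟨ count-all _ (λ _ → tt) (allFin a) ⟩
    length (allFin a)                                ≡⟨ length-allFin a ⟩
    a                                                ∎
    where
    open ≡-Reasoning
    fibers = map (fiber f) (allFin b)
    sum-filter-nonzero : ∀ ms → sum (filter (λ m → ¬? (m ≟ 0)) ms) ≡ sum ms
    sum-filter-nonzero [] = refl
    sum-filter-nonzero (zero ∷ ms) = sum-filter-nonzero ms
    sum-filter-nonzero (suc m ∷ ms) = cong (suc m +_) (sum-filter-nonzero ms)

selfHomCount : (F : Graph) {Q : Pred (List ℕ) 0ℓ} → Decidable Q → ℕ
selfHomCount F Q? = count (λ f → IsHom? F F f ×-dec Q? (homType f)) (allMaps (n F) (n F))

homTypes : ℕ → List (List ℕ)
homTypes N = deduplicate (List.≡-dec _≟_) (map homType (allMaps N N))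

length-≤-homTypes : ∀ N {τ} → τ ∈ homTypes N → length τ ≤ N
length-≤-homTypes N τ∈ with ∈-map⁻ homType (∈-deduplicate⁻ (List.≡-dec _≟_) _ τ∈)
... | f , _ , refl = length-homType-≤ f

selfHomCount-∑ : (F : Graph) {Q : Pred (List ℕ) 0ℓ} (Q? : Decidable Q) →
  selfHomCount F Q? ≡ ∑[ τ ∈ homTypes (n F) ] (indicator (Q? τ) * d F F τ)
selfHomCount-∑ F Q? = begin
  selfHomCount F Q?
    ≡⟨ count-filter (IsHom? F F) (Q? ∘ homType) maps ⟨
  count (Q? ∘ homType) (filter (IsHom? F F) maps)
    ≡⟨ count-by-value (List.≡-dec _≟_) homType Q? (deduplicate-! (List.≡-dec _≟_) _) (filter (IsHom? F F) maps) covered ⟩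
  ∑[ τ ∈ homTypes (n F) ] (indicator (Q? τ) * count (λ f → homType f ≟τ τ) (filter (IsHom? F F) maps))
    ≡⟨ ∑-cong (homTypes (n F)) (λ {τ} _ → cong (indicator (Q? τ) *_) (count-filter (IsHom? F F) (λ f → homType f ≟τ τ) maps)) ⟩
  ∑[ τ ∈ homTypes (n F) ] (indicator (Q? τ) * d F F τ)
    ∎
  where
  open ≡-Reasoning
  maps = allMaps (n F) (n F)
  _≟τ_ = List.≡-dec _≟_
  covered : ∀ {f} → f ∈ filter (IsHom? F F) maps → homType f ∈ homTypes (n F)
  covered f∈ = ∈-deduplicate⁺ _≟τ_ (∈-map⁺ homType (proj₁ (∈-filter⁻ (IsHom? F F) f∈)))

0<*⇒0<ˡ : ∀ {m n} → 0 < m * n → 0 < m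
0<*⇒0<ˡ {suc m} _ = s≤s z≤n

0<* : ∀ {m n} → 0 < m → 0 < n → 0 < m * n
0<* {suc m} {suc n} _ _ = s≤s z≤n

0<C : ∀ m k → k ≤ m → 0 < m C k
0<C m zero _ = s≤s z≤n
0<C (suc m) (suc k) (s≤s k≤m) =
  subst (0 <_) (nCk+nC[k+1]≡[n+1]C[k+1] m k) (≤-trans (0<C m k k≤m) (m≤m+n _ _))

0<multinomial : ∀ N rs → sum rs ≤ N → 0 < multinomial N rs
0<multinomial N [] _ = s≤s z≤n
0<multinomial N (r ∷ rs) r+rs≤N =
  0<* (0<C N r (≤-trans (m≤m+n r _) r+rs≤N))
      (0<multinomial (N ∸ r) rs (≤-trans (≤-reflexive (sym (m+n∸m≡n r (sum rs)))) (∸-monoˡ-≤ r r+rs≤N)))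

count-≡-≤1 : ∀ {A : Set} (_≟A_ : DecidableEquality A) x {ys : List A} → Unique ys → count (x ≟A_) ys ≤ 1
count-≡-≤1 _≟A_ x {ys} uys =
  unique-length-≤ {ys = x ∷ []} (Unique.filter⁺ (x ≟A_) uys) (λ z∈ → here (sym (proj₂ (∈-filter⁻ (x ≟A_) {xs = ys} z∈))))

∑-mult-≤ : ∀ {is : List ℕ} → Unique is → ∀ τ → ∑[ i ∈ is ] mult τ (suc i) ≤ length τ
∑-mult-≤ {is} uis [] = ≤-reflexive (∑-zero is (λ _ → refl))
∑-mult-≤ {is} uis (x ∷ τ) = begin
  ∑[ i ∈ is ] mult (x ∷ τ) (suc i)
    ≡⟨ ∑-cong is (λ {i} _ → count-∷ (_≟ suc i) x τ) ⟩
  ∑[ i ∈ is ] (indicator (x ≟ suc i) + mult τ (suc i))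
    ≡⟨ ∑-+ _ _ is ⟩
  ∑[ i ∈ is ] indicator (x ≟ suc i) + ∑[ i ∈ is ] mult τ (suc i)
    ≡⟨ cong (_+ _) (trans (∑-indicator (λ i → x ≟ suc i) is) (sym (count-map (x ≟_) suc is))) ⟩
  count (x ≟_) (map suc is) + ∑[ i ∈ is ] mult τ (suc i)
    ≤⟨ +-mono-≤ (count-≡-≤1 _≟_ x (Unique.map⁺ suc-injective uis)) (∑-mult-≤ uis τ) ⟩
  suc (length τ)
    ∎
  where open ≤-Reasoning

0<mCoeff : ∀ N τ → length τ ≤ N → 0 < mCoeff N τ
0<mCoeff N τ τ≤N = 0<multinomial N (map (λ i → mult τ (suc i)) (upTo (sum τ)))
  (≤-trans (≤-reflexive (sum-map (λ i → mult τ (suc i)) (upTo (sum τ))))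
           (≤-trans (∑-mult-≤ (Unique.upTo⁺ (sum τ)) τ) τ≤N))

0<d⇒sum≡n : (G : Graph) {τ : List ℕ} → 0 < d G G τ → sum τ ≡ n G
0<d⇒sum≡n G {τ} 0<d with count>0⇒∈ (λ f → IsHom? G G f ×-dec List.≡-dec _≟_ (homType f) τ) (allMaps (n G) (n G)) 0<d
... | f , _ , _ , type≡ = trans (cong sum (sym type≡)) (sum-homType f)

0<d-identity : (G : Graph) → 0 < d G G (homType (tabulate {n = n G} id))
0<d-identity G = ∈⇒count>0 (λ f → IsHom? G G f ×-dec List.≡-dec _≟_ (homType f) (homType identity)) (allMaps-complete _ _ identity)
  ((λ u v uv → subst₂ (E G) (sym (lookup∘tabulate id u)) (sym (lookup∘tabulate id v)) uv) , refl)
  where identity = tabulate {n = n G} id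

X-≡⇒vertexCount-≡ : (F₁ F₂ : Graph) → X F₁ F₁ ≡Sym X F₂ F₂ → n F₁ ≡ n F₂
X-≡⇒vertexCount-≡ F₁ F₂ X≡ = trans (sym (0<d⇒sum≡n F₁ (0<d-identity F₁))) (0<d⇒sum≡n F₂ 0<d₂)
  where
  τ = homType (tabulate {n = n F₁} id)
  0<d₂ : 0 < d F₂ F₂ τ
  0<d₂ = 0<*⇒0<ˡ (subst (0 <_) (X≡ τ) (0<* (0<d-identity F₁) (0<mCoeff (n F₁) τ (length-homType-≤ (tabulate id)))))

X-≡⇒selfHomCount-≡ : (F₁ F₂ : Graph) → X F₁ F₁ ≡Sym X F₂ F₂ →
  ∀ {Q : Pred (List ℕ) 0ℓ} (Q? : Decidable Q) → selfHomCount F₁ Q? ≡ selfHomCount F₂ Q?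
X-≡⇒selfHomCount-≡ F₁ F₂ X≡ Q? = begin
  selfHomCount F₁ Q?                                       ≡⟨ selfHomCount-∑ F₁ Q? ⟩
  ∑[ τ ∈ homTypes (n F₁) ] (indicator (Q? τ) * d F₁ F₁ τ)
    ≡⟨ cong (λ N → ∑[ τ ∈ homTypes N ] (indicator (Q? τ) * d F₁ F₁ τ)) N≡ ⟩
  ∑[ τ ∈ homTypes (n F₂) ] (indicator (Q? τ) * d F₁ F₁ τ)
    ≡⟨ ∑-cong (homTypes (n F₂)) (λ {τ} τ∈ → cong (indicator (Q? τ) *_) (d≡ τ (length-≤-homTypes _ τ∈))) ⟩
  ∑[ τ ∈ homTypes (n F₂) ] (indicator (Q? τ) * d F₂ F₂ τ)  ≡⟨ selfHomCount-∑ F₂ Q? ⟨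
  selfHomCount F₂ Q?                                       ∎
  where
  open ≡-Reasoning
  N≡ = X-≡⇒vertexCount-≡ F₁ F₂ X≡
  d≡ : ∀ τ → length τ ≤ n F₂ → d F₁ F₁ τ ≡ d F₂ F₂ τ
  d≡ τ τ≤N = *-cancelʳ-≡ (d F₁ F₁ τ) (d F₂ F₂ τ) (mCoeff (n F₂) τ) {{>-nonZero (0<mCoeff (n F₂) τ τ≤N)}}
    (trans (cong (λ N → d F₁ F₁ τ * mCoeff N τ) (sym N≡)) (X≡ τ))

module _ (G : Graph) where

  E-sym : ∀ {u v} → E G u v → E G v u
  E-sym {u} {v} uv = trans (Graph.sym G v u) uv

  E⇒≢ : ∀ {u v} → E G u v → u ≢ v
  E⇒≢ {u} uu refl with trans (sym uu) (irrefl G u)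
  ... | ()

  NonBacktracking : List (Fin (n G)) → Set
  NonBacktracking [] = ⊤
  NonBacktracking (x ∷ []) = ⊤
  NonBacktracking (x ∷ y ∷ []) = E G x y
  NonBacktracking (x ∷ y ∷ z ∷ r) = E G x y × x ≢ z × NonBacktracking (y ∷ z ∷ r)

  nb-tail : ∀ {x} xs → NonBacktracking (x ∷ xs) → NonBacktracking xs
  nb-tail [] _ = tt
  nb-tail (y ∷ []) _ = tt
  nb-tail (y ∷ z ∷ r) (_ , _ , nb) = nb

  nb-edge : ∀ {x y} r → NonBacktracking (x ∷ y ∷ r) → E G x y
  nb-edge [] xy = xy
  nb-edge (z ∷ r) (xy , _) = xy

  nb-cons : ∀ {x y z r} → E G x y → x ≢ z → NonBacktracking (y ∷ z ∷ r) → NonBacktracking (x ∷ y ∷ z ∷ r)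
  nb-cons xy x≢z nb = xy , x≢z , nb

  nb⇒linked : ∀ xs → NonBacktracking xs → Linked (E G) xs
  nb⇒linked [] _ = []
  nb⇒linked (x ∷ []) _ = [-]
  nb⇒linked (x ∷ y ∷ r) nb = nb-edge r nb ∷ nb⇒linked (y ∷ r) (nb-tail (y ∷ r) nb)

  forest-nb-head∉ : Forest G → ∀ x rest → NonBacktracking (x ∷ rest) → Unique rest → All (x ≢_) rest
  forest-nb-head∉ forest x rest nb unique-rest = All.tabulate x∉rest
    where
    returns : ∀ ws {more} → rest ≡ ws ++ x ∷ more → ⊥
    returns [] {more} refl = E⇒≢ (nb-edge more nb) refl
    returns (y ∷ []) refl = proj₁ (proj₂ nb) refl
    returns (y ∷ y′ ∷ ws) {more} refl = forest (x ∷ cycle) (s≤s (s≤s z≤n) , x∉cycle ∷ unique-++⁻ˡ cycle unique-rest , closed)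
      where
      cycle = y ∷ y′ ∷ ws
      x∉cycle : All (x ≢_) cycle
      x∉cycle = All.tabulate (λ x′∈ x≡x′ → unique-∉-prefix cycle unique-rest (subst (_∈ cycle) (sym x≡x′) x′∈))
      closed : Linked (E G) (x ∷ cycle ++ x ∷ [])
      closed = linked-prefix (x ∷ cycle) (nb⇒linked (x ∷ rest) nb)
    x∉rest : ∀ {y} → y ∈ rest → x ≢ y
    x∉rest y∈ refl with ∈-∃++ y∈
    ... | ws , _ , rest≡ = returns ws rest≡

  forest-nb⇒unique : Forest G → ∀ xs → NonBacktracking xs → Unique xs
  forest-nb⇒unique forest [] _ = []
  forest-nb⇒unique forest (x ∷ rest) nb = forest-nb-head∉ forest x rest nb unique-rest ∷ unique-rest
    where
    unique-rest : Unique rest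
    unique-rest = forest-nb⇒unique forest rest (nb-tail rest nb)

data Joins {A : Set} : A → A → List A → Set where
  single : ∀ {a} → Joins a a (a ∷ [])
  cons : ∀ {a b c xs} → Joins b c (b ∷ xs) → Joins a c (a ∷ b ∷ xs)

joins-end-∈ : ∀ {A : Set} {a c : A} {xs} → Joins a c xs → c ∈ xs
joins-end-∈ single = here refl
joins-end-∈ (cons j) = there (joins-end-∈ j)

ʳ++-unique : ∀ {A : Set} (xs : List A) {ys} → Unique (xs ʳ++ ys) → Unique ys × (∀ {z} → z ∈ xs → z ∉ ys)
ʳ++-unique [] u = u , λ ()
ʳ++-unique (x ∷ xs) {ys} u with ʳ++-unique xs u
... | x∉ys ∷ uys , disjoint = uys , λ { (here refl) z∈ys → All.lookup x∉ys z∈ys refl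
                                       ; (there z∈xs) z∈ys → disjoint z∈xs (there z∈ys) }

module _ (G : Graph) where

  nb-ʳ++ : ∀ ys {a b acc} → NonBacktracking G (b ∷ a ∷ ys) → NonBacktracking G (a ∷ b ∷ acc) →
    NonBacktracking G (ys ʳ++ (a ∷ b ∷ acc))
  nb-ʳ++ [] _ nb = nb
  nb-ʳ++ (y ∷ ys) {a} {b} nbys nbacc =
    nb-ʳ++ ys (nb-tail G (a ∷ y ∷ ys) nbys)
      (nb-cons G (E-sym G (nb-edge G ys (nb-tail G (a ∷ y ∷ ys) nbys))) (λ y≡b → proj₁ (proj₂ nbys) (sym y≡b)) nbacc)

  nb-joins-unique : Forest G → ∀ {h l P Q} → Joins h l P → NonBacktracking G P → Joins h l Q → NonBacktracking G Q → P ≡ Q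
  nb-joins-unique forest single _ single _ = refl
  nb-joins-unique forest single _ (cons j) nb with forest-nb⇒unique G forest _ nb
  ... | h∉ ∷ _ = ⊥-elim (All.lookup h∉ (joins-end-∈ j) refl)
  nb-joins-unique forest (cons j) nb single _ with forest-nb⇒unique G forest _ nb
  ... | h∉ ∷ _ = ⊥-elim (All.lookup h∉ (joins-end-∈ j) refl)
  nb-joins-unique forest {h} (cons {b = z} {xs = ys} j) nb (cons {b = z′} {xs = ys′} j′) nb′ with z Fin.≟ z′
  ... | yes refl = cong (h ∷_) (nb-joins-unique forest j (nb-tail G (z ∷ ys) nb) j′ (nb-tail G (z ∷ ys′) nb′))
  ... | no z≢z′ = ⊥-elim (proj₂ (ʳ++-unique (z ∷ ys) (forest-nb⇒unique G forest _ there-and-back))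
                        (joins-end-∈ j) (there (joins-end-∈ j′)))
    where
    there-and-back : NonBacktracking G (ys ʳ++ (z ∷ h ∷ z′ ∷ ys′))
    there-and-back = nb-ʳ++ ys nb (nb-cons G (E-sym G (nb-edge G ys nb)) z≢z′ nb′)

secondOr : {A : Set} → A → List A → A
secondOr _ (_ ∷ y ∷ _) = y
secondOr d _ = d

parity : ℕ → Bool
parity zero = false
parity (suc m) = not (parity m)

module RootedForest (F : Graph) (forest : Forest F) {k : ℕ} (components : HasComponents F k) where

  V : Set
  V = Fin (n F)

  component : V → Fin k
  component = proj₁ components

  root : Fin k → V
  root i = proj₁ (proj₁ (proj₂ components) i)

  component-root : ∀ i → component (root i) ≡ i
  component-root i = proj₂ (proj₁ (proj₂ components) i)

  E⇒same-component : ∀ {u v} → E F u v → component u ≡ component v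
  E⇒same-component {u} {v} uv = proj₂ (proj₂ (proj₂ components) u v) (step uv here)

  NBPath : V → V → Set
  NBPath v r = Σ (List V) λ P → Joins v r P × NonBacktracking F P

  nbPath-step : ∀ {s r w} → NBPath s r → E F s w → NBPath w r
  nbPath-step (s ∷ [] , single , _) sw = _ , cons single , E-sym F sw
  nbPath-step {w = w} (s ∷ t ∷ S , cons j , nb) sw with t Fin.≟ w
  ... | yes refl = t ∷ S , j , nb-tail F (t ∷ S) nb
  ... | no t≢w = w ∷ s ∷ t ∷ S , cons (cons j) , nb-cons F (E-sym F sw) (λ w≡t → t≢w (sym w≡t)) nb

  walk⇒nbPath : ∀ {s r v} → NBPath s r → Walk F s v → NBPath v r
  walk⇒nbPath p here = p
  walk⇒nbPath p (step sw walk) = walk⇒nbPath (nbPath-step p sw) walk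

  rootPath-nbPath : ∀ v → NBPath v (root (component v))
  rootPath-nbPath v = walk⇒nbPath (_ ∷ [] , single , tt) (proj₁ (proj₂ (proj₂ components) _ v) (component-root (component v)))

  rootPath : V → List V
  rootPath v = proj₁ (rootPath-nbPath v)

  rootPath-joins : ∀ v → Joins v (root (component v)) (rootPath v)
  rootPath-joins v = proj₁ (proj₂ (rootPath-nbPath v))

  rootPath-nb : ∀ v → NonBacktracking F (rootPath v)
  rootPath-nb v = proj₂ (proj₂ (rootPath-nbPath v))

  rootPath-unique : ∀ {v r P} → Joins v r P → NonBacktracking F P → r ≡ root (component v) → P ≡ rootPath v
  rootPath-unique {v} j nb refl = nb-joins-unique F forest j nb (rootPath-joins v) (rootPath-nb v)

  rootPath-head : ∀ v → ∃ λ T → rootPath v ≡ v ∷ T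
  rootPath-head v = head (rootPath-joins v)
    where
    head : ∀ {r P} → Joins v r P → ∃ λ T → P ≡ v ∷ T
    head single = _ , refl
    head (cons _) = _ , refl

  edge-rootPath : ∀ {u v} → E F u v → rootPath v ≡ v ∷ rootPath u ⊎ rootPath u ≡ u ∷ rootPath v
  edge-rootPath {u} {v} uv = from-path (rootPath u) (rootPath-joins u) (rootPath-nb u) refl refl
    where
    same-root : root (component u) ≡ root (component v)
    same-root = cong root (E⇒same-component uv)
    from-path : ∀ {r} P → Joins u r P → NonBacktracking F P → P ≡ rootPath u → r ≡ root (component u) →
      rootPath v ≡ v ∷ rootPath u ⊎ rootPath u ≡ u ∷ rootPath v
    from-path (u ∷ []) single _ P≡ r≡ =
      inj₁ (trans (sym (rootPath-unique (cons single) (E-sym F uv) (trans r≡ same-root))) (cong (v ∷_) P≡))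
    from-path (u ∷ t ∷ S) (cons j) nb P≡ r≡ with t Fin.≟ v
    ... | yes refl = inj₂ (trans (sym P≡) (cong (u ∷_) (rootPath-unique j (nb-tail F (t ∷ S) nb) (trans r≡ same-root))))
    ... | no t≢v = inj₁ (trans (sym (rootPath-unique (cons (cons j)) (nb-cons F (E-sym F uv) (λ v≡t → t≢v (sym v≡t)) nb)
                                                      (trans r≡ same-root)))
                               (cong (v ∷_) P≡))

  IsRoot : V → Set
  IsRoot v = v ≡ root (component v)

  IsRoot? : Decidable IsRoot
  IsRoot? v = v Fin.≟ root (component v)

  root-isRoot : ∀ i → IsRoot (root i)
  root-isRoot i = cong root (sym (component-root i))

  rootPath-root : ∀ {v} → IsRoot v → rootPath v ≡ v ∷ []
  rootPath-root {v} isRoot = sym (rootPath-unique single tt isRoot)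

  parent : V → V
  parent v = secondOr v (rootPath v)

  rootPath-parent : ∀ {w} → ¬ IsRoot w → rootPath w ≡ w ∷ rootPath (parent w)
  rootPath-parent {w} ¬root = from-path (rootPath w) (rootPath-joins w) (rootPath-nb w) refl refl
    where
    from-path : ∀ {r} P → Joins w r P → NonBacktracking F P → P ≡ rootPath w → r ≡ root (component w) →
      rootPath w ≡ w ∷ rootPath (parent w)
    from-path (w ∷ []) single _ _ r≡ = ⊥-elim (¬root r≡)
    from-path (w ∷ t ∷ S) (cons j) nb P≡ r≡ = begin
      rootPath w       ≡⟨ P≡ ⟨
      w ∷ t ∷ S        ≡⟨ cong (w ∷_) (rootPath-unique j (nb-tail F (t ∷ S) nb) (trans r≡ (cong root same-component))) ⟩
      w ∷ rootPath t   ≡⟨ cong (λ P → w ∷ rootPath (secondOr w P)) P≡ ⟩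
      w ∷ rootPath (parent w) ∎
      where
      open ≡-Reasoning
      same-component : component w ≡ component t
      same-component = E⇒same-component (nb-edge F S nb)

  parent-edge : ∀ {w} → ¬ IsRoot w → E F w (parent w)
  parent-edge {w} ¬root with rootPath-head (parent w)
  ... | T , head≡ = nb-edge F T (subst (NonBacktracking F) (trans (rootPath-parent ¬root) (cong (w ∷_) head≡)) (rootPath-nb w))

  parent≢ : ∀ {w} → ¬ IsRoot w → w ≢ parent w
  parent≢ ¬root = E⇒≢ F (parent-edge ¬root)

  rootPath-step⇒parent : ∀ {u v} → rootPath v ≡ v ∷ rootPath u → ¬ IsRoot v × parent v ≡ u
  rootPath-step⇒parent {u} {v} v→u with rootPath-head u
  ... | T , head≡ = ¬root , parent≡
    where
    ¬root : ¬ IsRoot v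
    ¬root isRoot with trans (sym head≡) (List.∷-injectiveʳ (trans (sym v→u) (rootPath-root isRoot)))
    ... | ()
    parent≡ : parent v ≡ u
    parent≡ = trans (cong (secondOr v) v→u) (cong (secondOr v ∘ (v ∷_)) head≡)

  edge⇒parent-edge : ∀ {u v} → E F u v → (¬ IsRoot v × parent v ≡ u) ⊎ (¬ IsRoot u × parent u ≡ v)
  edge⇒parent-edge uv with edge-rootPath uv
  ... | inj₁ v→u = inj₁ (rootPath-step⇒parent v→u)
  ... | inj₂ u→v = inj₂ (rootPath-step⇒parent u→v)

  parent-no-2-cycle : ∀ {w w′} → ¬ IsRoot w → ¬ IsRoot w′ → parent w ≡ w′ → parent w′ ≡ w → ⊥
  parent-no-2-cycle {w} {w′} ¬root ¬root′ parent≡ parent′≡ = m≢2+m (length (rootPath w)) (begin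
    length (rootPath w)                       ≡⟨ cong length (rootPath-parent ¬root) ⟩
    suc (length (rootPath (parent w)))        ≡⟨ cong (suc ∘ length ∘ rootPath) parent≡ ⟩
    suc (length (rootPath w′))                ≡⟨ cong (suc ∘ length) (rootPath-parent ¬root′) ⟩
    suc (suc (length (rootPath (parent w′)))) ≡⟨ cong (suc ∘ suc ∘ length ∘ rootPath) parent′≡ ⟩
    suc (suc (length (rootPath w)))           ∎)
    where
    open ≡-Reasoning
    m≢2+m : ∀ m → m ≢ suc (suc m)
    m≢2+m zero ()
    m≢2+m (suc m) eq = m≢2+m m (suc-injective eq)

  depthParity : V → Bool
  depthParity v = parity (length (rootPath v))

  depthParity-edge : ∀ {u v} → E F u v → depthParity u ≡ not (depthParity v)
  depthParity-edge {u} {v} uv with edge-rootPath uv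
  ... | inj₁ v→u = trans (sym (not-involutive (depthParity u))) (cong not (sym (cong (parity ∘ length) v→u)))
  ... | inj₂ u→v = cong (parity ∘ length) u→v

  edge-invariant⇒root-invariant : {B : Set} (g : V → B) → (∀ {u v} → E F u v → g u ≡ g v) → ∀ v → g v ≡ g (root (component v))
  edge-invariant⇒root-invariant g invariant v = along (rootPath-joins v) (rootPath-nb v)
    where
    along : ∀ {u r P} → Joins u r P → NonBacktracking F P → g u ≡ g r
    along single _ = refl
    along {P = u ∷ t ∷ S} (cons j) nb = trans (invariant (nb-edge F S nb)) (along j (nb-tail F (t ∷ S) nb))

  nonRoots : List V
  nonRoots = filter (¬? ∘ IsRoot?) (allFin (n F))

  ∈-nonRoots⁺ : ∀ {v} → ¬ IsRoot v → v ∈ nonRoots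
  ∈-nonRoots⁺ {v} ¬root = ∈-filter⁺ (¬? ∘ IsRoot?) (∈-allFin v) ¬root

  ∈-nonRoots⁻ : ∀ {v} → v ∈ nonRoots → ¬ IsRoot v
  ∈-nonRoots⁻ v∈ = proj₂ (∈-filter⁻ (¬? ∘ IsRoot?) {xs = allFin (n F)} v∈)

  count-roots : count IsRoot? (allFin (n F)) ≡ k
  count-roots = trans
    (unique-length-≡ (Unique.filter⁺ IsRoot? (Unique.allFin⁺ (n F))) (Unique.map⁺ root-injective (Unique.allFin⁺ k)) roots⊆ ⊆roots)
    (trans (length-map root (allFin k)) (length-allFin k))
    where
    root-injective : ∀ {i j} → root i ≡ root j → i ≡ j
    root-injective {i} {j} eq = trans (sym (component-root i)) (trans (cong component eq) (component-root j))
    roots⊆ : ∀ {v} → v ∈ filter IsRoot? (allFin (n F)) → v ∈ map root (allFin k)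
    roots⊆ {v} v∈ = subst (_∈ map root (allFin k)) (sym (proj₂ (∈-filter⁻ IsRoot? {xs = allFin (n F)} v∈)))
                          (∈-map⁺ root (∈-allFin (component v)))
    ⊆roots : ∀ {v} → v ∈ map root (allFin k) → v ∈ filter IsRoot? (allFin (n F))
    ⊆roots v∈ with ∈-map⁻ root v∈
    ... | i , _ , refl = ∈-filter⁺ IsRoot? (∈-allFin (root i)) (root-isRoot i)

  length-nonRoots+k : length nonRoots + k ≡ n F
  length-nonRoots+k = begin
    length nonRoots + k                                     ≡⟨ +-comm (length nonRoots) k ⟩
    k + length nonRoots                                     ≡⟨ cong (_+ length nonRoots) count-roots ⟨
    count IsRoot? (allFin (n F)) + length nonRoots          ≡⟨ count+count-¬ IsRoot? (allFin (n F)) ⟩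
    length (allFin (n F))                                   ≡⟨ length-allFin (n F) ⟩
    n F                                                     ∎
    where open ≡-Reasoning

bit : Fin 2 → Bool
bit Fin.zero = false
bit (Fin.suc _) = true

fromBit : Bool → Fin 2
fromBit false = Fin.zero
fromBit true = Fin.suc Fin.zero

bit-fromBit : ∀ b → bit (fromBit b) ≡ b
bit-fromBit false = refl
bit-fromBit true = refl

bit-injective : ∀ {x y} → bit x ≡ bit y → x ≡ y
bit-injective {Fin.zero} {Fin.zero} _ = refl
bit-injective {Fin.suc Fin.zero} {Fin.suc Fin.zero} _ = refl

xor-cancelʳ : ∀ a b → (a xor b) xor b ≡ a
xor-cancelʳ a b = trans (xor-assoc a b b) (trans (cong (a xor_) (xor-same b)) (xor-identityʳ a))

not-xor-not : ∀ a b → not a xor not b ≡ a xor b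
not-xor-not a b = trans (sym (not-distribˡ-xor a (not b))) (trans (cong not (sym (not-distribʳ-xor a b))) (not-involutive (a xor b)))

module HomsOntoAnEdge (F : Graph) (forest : Forest F) {k : ℕ} (components : HasComponents F k) where
  open RootedForest F forest components

  endpoint : Bool → V → V
  endpoint true w = w
  endpoint false w = parent w

  endpoint-edge : ∀ {w} → ¬ IsRoot w → ∀ b → E F (endpoint b w) (endpoint (not b) w)
  endpoint-edge ¬root true = parent-edge ¬root
  endpoint-edge ¬root false = E-sym F (parent-edge ¬root)

  endpoint-injective : ∀ {w} → ¬ IsRoot w → ∀ {b b′} → endpoint b w ≡ endpoint b′ w → b ≡ b′
  endpoint-injective ¬root {true} {true} _ = refl
  endpoint-injective ¬root {true} {false} eq = ⊥-elim (parent≢ ¬root eq)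
  endpoint-injective ¬root {false} {true} eq = ⊥-elim (parent≢ ¬root (sym eq))
  endpoint-injective ¬root {false} {false} _ = refl

  side : Vec (Fin 2) k → V → Bool
  side s v = bit (lookup s (component v)) xor depthParity v

  side-edge : ∀ s {u v} → E F u v → side s u ≡ not (side s v)
  side-edge s {u} {v} uv = begin
    bit (lookup s (component u)) xor depthParity u        ≡⟨ cong₂ (λ i p → bit (lookup s i) xor p) (E⇒same-component uv) (depthParity-edge uv) ⟩
    bit (lookup s (component v)) xor not (depthParity v)  ≡⟨ not-distribʳ-xor (bit (lookup s (component v))) (depthParity v) ⟨
    not (side s v)                                        ∎
    where open ≡-Reasoning

  edgeHom : V × Vec (Fin 2) k → Vec V (n F)
  edgeHom (w , s) = tabulate λ v → endpoint (side s v) w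

  lookup-edgeHom : ∀ w s v → lookup (edgeHom (w , s)) v ≡ endpoint (side s v) w
  lookup-edgeHom w s v = lookup∘tabulate _ v

  edgeHom-isHom : ∀ {w} s → ¬ IsRoot w → IsHom F F (edgeHom (w , s))
  edgeHom-isHom {w} s ¬root u v uv =
    subst₂ (E F) (sym (lookup-edgeHom w s u)) (sym (trans (lookup-edgeHom w s v) (cong (λ b → endpoint b w) v≡)))
      (endpoint-edge ¬root (side s u))
    where
    v≡ : side s v ≡ not (side s u)
    v≡ = side-edge s (E-sym F uv)

  edgeHom-image : ∀ w s {z} → InImage (edgeHom (w , s)) z → z ≡ w ⊎ z ≡ parent w
  edgeHom-image w s (u , eq) with side s u | trans (sym (lookup-edgeHom w s u)) eq
  ... | true | w≡z = inj₁ (sym w≡z)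
  ... | false | parent≡z = inj₂ (sym parent≡z)

  edgeHom-hit : ∀ w s v {b} → side s v ≡ b → InImage (edgeHom (w , s)) (endpoint b w)
  edgeHom-hit w s v side≡ = v , trans (lookup-edgeHom w s v) (cong (λ b → endpoint b w) side≡)

  side-parent : ∀ s {w} → ¬ IsRoot w → side s (parent w) ≡ not (side s w)
  side-parent s ¬root = side-edge s (E-sym F (parent-edge ¬root))

  edgeHom-hits : ∀ {w} s → ¬ IsRoot w → InImage (edgeHom (w , s)) w × InImage (edgeHom (w , s)) (parent w)
  edgeHom-hits {w} s ¬root with side s w in eq
  ... | true = edgeHom-hit w s w eq , edgeHom-hit w s (parent w) (trans (side-parent s ¬root) (cong not eq))
  ... | false = edgeHom-hit w s (parent w) (trans (side-parent s ¬root) (cong not eq)) , edgeHom-hit w s w eq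

  edgeHom-imageSize : ∀ {w} s → ¬ IsRoot w → length (homType (edgeHom (w , s))) ≡ 2
  edgeHom-imageSize {w} s ¬root = length-homType-≡ (edgeHom (w , s)) ((parent≢ ¬root ∷ []) ∷ [] ∷ [])
    (λ i → [ (λ { refl → here refl }) , (λ { refl → there (here refl) }) ] (edgeHom-image w s i))
    (λ { (here refl) → proj₁ (edgeHom-hits s ¬root) ; (there (here refl)) → proj₂ (edgeHom-hits s ¬root) })

  edgeHomParameters : List (V × Vec (Fin 2) k)
  edgeHomParameters = cartesianProduct nonRoots (allMaps k 2)

  ∈-edgeHomParameters⁻ : ∀ {w s} → (w , s) ∈ edgeHomParameters → ¬ IsRoot w
  ∈-edgeHomParameters⁻ p∈ = ∈-nonRoots⁻ (proj₁ (∈-cartesianProduct⁻ nonRoots (allMaps k 2) p∈))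

  edgeHom-injective : ∀ {p q} → p ∈ edgeHomParameters → q ∈ edgeHomParameters → edgeHom p ≡ edgeHom q → p ≡ q
  edgeHom-injective {w , s} {w′ , s′} p∈ q∈ eq
    with ∈-edgeHomParameters⁻ p∈ | ∈-edgeHomParameters⁻ q∈
  ... | ¬root | ¬root′
    with edgeHom-image w′ s′ (subst (λ f → InImage f w) eq (proj₁ (edgeHom-hits s ¬root)))
       | edgeHom-image w′ s′ (subst (λ f → InImage f (parent w)) eq (proj₂ (edgeHom-hits s ¬root)))
  ... | inj₂ w≡parent′ | inj₁ parent≡w′ = ⊥-elim (parent-no-2-cycle ¬root ¬root′ parent≡w′ (sym w≡parent′))
  ... | inj₂ w≡parent′ | inj₂ parent≡parent′ = ⊥-elim (parent≢ ¬root (trans w≡parent′ (sym parent≡parent′)))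
  ... | inj₁ refl | _ = cong (w ,_) (lookup-ext λ i → bit-injective (same-bit i))
    where
    same-side : ∀ v → side s v ≡ side s′ v
    same-side v = endpoint-injective ¬root (trans (sym (lookup-edgeHom w s v)) (trans (cong (λ f → lookup f v) eq) (lookup-edgeHom w s′ v)))
    same-bit : ∀ i → bit (lookup s i) ≡ bit (lookup s′ i)
    same-bit i = subst (λ j → bit (lookup s j) ≡ bit (lookup s′ j)) (component-root i)
      (trans (sym (xor-cancelʳ _ (depthParity (root i)))) (trans (cong (_xor depthParity (root i)) (same-side (root i))) (xor-cancelʳ _ _)))

  module _ (f : Vec V (n F)) (isHom : IsHom F F f) {w : V} (¬root : ¬ IsRoot w)
           (image⊆ : ∀ {z} → InImage f z → z ≡ w ⊎ z ≡ parent w) where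

    hitsW : V → Bool
    hitsW v = does (lookup f v Fin.≟ w)

    lookup-f : ∀ v → lookup f v ≡ endpoint (hitsW v) w
    lookup-f v with lookup f v Fin.≟ w
    ... | yes fv≡w = fv≡w
    ... | no fv≢w = [ (λ fv≡w → ⊥-elim (fv≢w fv≡w)) , id ] (image⊆ (v , refl))

    hitsW-edge : ∀ {u v} → E F u v → hitsW u ≡ not (hitsW v)
    hitsW-edge {u} {v} uv = ¬-not λ same → E⇒≢ F (isHom u v uv)
      (trans (lookup-f u) (trans (cong (λ b → endpoint b w) same) (sym (lookup-f v))))

    colouringOf : Vec (Fin 2) k
    colouringOf = tabulate λ i → fromBit (hitsW (root i) xor depthParity (root i))

    invariant : V → Bool
    invariant u = hitsW u xor depthParity u

    invariant-edge : ∀ {u v} → E F u v → invariant u ≡ invariant v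
    invariant-edge {u} {v} uv = trans (cong₂ _xor_ (hitsW-edge uv) (depthParity-edge uv)) (not-xor-not (hitsW v) (depthParity v))

    side-colouringOf : ∀ v → side colouringOf v ≡ hitsW v
    side-colouringOf v = begin
      bit (lookup colouringOf (component v)) xor depthParity v
        ≡⟨ cong (λ b → bit b xor depthParity v) (lookup∘tabulate (fromBit ∘ invariant ∘ root) (component v)) ⟩
      bit (fromBit (invariant (root (component v)))) xor depthParity v
        ≡⟨ cong (_xor depthParity v) (bit-fromBit (invariant (root (component v)))) ⟩
      invariant (root (component v)) xor depthParity v
        ≡⟨ cong (_xor depthParity v) (edge-invariant⇒root-invariant invariant invariant-edge v) ⟨
      invariant v xor depthParity v
        ≡⟨ xor-cancelʳ (hitsW v) (depthParity v) ⟩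
      hitsW v
        ∎
      where open ≡-Reasoning

    edgeHom-colouringOf : edgeHom (w , colouringOf) ≡ f
    edgeHom-colouringOf = lookup-ext λ v →
      trans (lookup-edgeHom w colouringOf v) (trans (cong (λ b → endpoint b w) (side-colouringOf v)) (sym (lookup-f v)))

  edgeHom-surjective : ∀ {w₀} → ¬ IsRoot w₀ → ∀ f → IsHom F F f → length (homType f) ≡ 2 →
    ∃ λ p → p ∈ edgeHomParameters × edgeHom p ≡ f
  edgeHom-surjective {w₀} ¬root₀ f isHom size≡2 with imageSize≡2⇒ f size≡2
  ... | a , b , a≢b , image⊆ = from-parent-edge (edge⇒parent-edge ab)
    where
    image-edge : E F (lookup f w₀) (lookup f (parent w₀))
    image-edge = isHom w₀ (parent w₀) (parent-edge ¬root₀)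
    ab : E F a b
    ab with image⊆ (w₀ , refl) | image⊆ (parent w₀ , refl)
    ... | inj₁ x≡a | inj₁ y≡a = ⊥-elim (E⇒≢ F image-edge (trans x≡a (sym y≡a)))
    ... | inj₁ x≡a | inj₂ y≡b = subst₂ (E F) x≡a y≡b image-edge
    ... | inj₂ x≡b | inj₁ y≡a = E-sym F (subst₂ (E F) x≡b y≡a image-edge)
    ... | inj₂ x≡b | inj₂ y≡b = ⊥-elim (E⇒≢ F image-edge (trans x≡b (sym y≡b)))
    from-parent-edge : (¬ IsRoot b × parent b ≡ a) ⊎ (¬ IsRoot a × parent a ≡ b) → ∃ λ p → p ∈ edgeHomParameters × edgeHom p ≡ f
    from-parent-edge (inj₁ (¬root , refl)) =
      (b , s) , ∈-cartesianProduct⁺ (∈-nonRoots⁺ ¬root) (allMaps-complete k 2 s) , edgeHom-colouringOf f isHom ¬root image⊆′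
      where
      image⊆′ : ∀ {z} → InImage f z → z ≡ b ⊎ z ≡ parent b
      image⊆′ = Sum.swap ∘ image⊆
      s = colouringOf f isHom ¬root image⊆′
    from-parent-edge (inj₂ (¬root , refl)) =
      (a , s) , ∈-cartesianProduct⁺ (∈-nonRoots⁺ ¬root) (allMaps-complete k 2 s) , edgeHom-colouringOf f isHom ¬root image⊆
      where s = colouringOf f isHom ¬root image⊆

  count-imageSize≡2 : ∀ {w₀} → ¬ IsRoot w₀ → selfHomCount F (λ τ → length τ ≟ 2) ≡ length nonRoots * 2 ^ k
  count-imageSize≡2 ¬root₀ = begin
    length (filter P? (allMaps (n F) (n F)))
      ≡⟨ unique-length-≡ (Unique.filter⁺ P? (allMaps-unique (n F) (n F)))
                         (map-unique-on edgeHom parameters-unique edgeHom-injective) ⊆image ⊇image ⟩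
    length (map edgeHom edgeHomParameters)
      ≡⟨ length-map edgeHom edgeHomParameters ⟩
    length edgeHomParameters
      ≡⟨ length-cartesianProduct nonRoots (allMaps k 2) ⟩
    length nonRoots * length (allMaps k 2)
      ≡⟨ cong (length nonRoots *_) (length-allMaps k 2) ⟩
    length nonRoots * 2 ^ k
      ∎
    where
    open ≡-Reasoning
    P? : Decidable (λ f → IsHom F F f × length (homType f) ≡ 2)
    P? f = IsHom? F F f ×-dec (length (homType f) ≟ 2)
    parameters-unique : Unique edgeHomParameters
    parameters-unique = Unique.cartesianProduct⁺ (Unique.filter⁺ (¬? ∘ IsRoot?) (Unique.allFin⁺ (n F))) (allMaps-unique k 2)
    ⊆image : ∀ {f} → f ∈ filter P? (allMaps (n F) (n F)) → f ∈ map edgeHom edgeHomParameters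
    ⊆image {f} f∈ with ∈-filter⁻ P? {xs = allMaps (n F) (n F)} f∈
    ... | _ , isHom , size≡2 with edgeHom-surjective ¬root₀ f isHom size≡2
    ... | p , p∈ , p↦f = subst (_∈ map edgeHom edgeHomParameters) p↦f (∈-map⁺ edgeHom p∈)
    ⊇image : ∀ {f} → f ∈ map edgeHom edgeHomParameters → f ∈ filter P? (allMaps (n F) (n F))
    ⊇image f∈ with ∈-map⁻ edgeHom f∈
    ... | (w , s) , p∈ , refl = ∈-filter⁺ P? (allMaps-complete (n F) (n F) _)
                                  (edgeHom-isHom s (∈-edgeHomParameters⁻ p∈) , edgeHom-imageSize s (∈-edgeHomParameters⁻ p∈))

Extends : ∀ {a b} → Vec (Maybe (Fin b)) a → Vec (Fin b) a → Set
Extends [] [] = ⊤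
Extends (nothing ∷ ρ) (_ ∷ f) = Extends ρ f
Extends (just α ∷ ρ) (x ∷ f) = x ≡ α × Extends ρ f

extends? : ∀ {a b} (ρ : Vec (Maybe (Fin b)) a) → Decidable (Extends ρ)
extends? [] [] = yes tt
extends? (nothing ∷ ρ) (_ ∷ f) = extends? ρ f
extends? (just α ∷ ρ) (x ∷ f) = (x Fin.≟ α) ×-dec extends? ρ f

definedCount : ∀ {a b} → Vec (Maybe (Fin b)) a → ℕ
definedCount [] = 0
definedCount (nothing ∷ ρ) = definedCount ρ
definedCount (just _ ∷ ρ) = suc (definedCount ρ)

count-extensions : ∀ a b (ρ : Vec (Maybe (Fin b)) a) → count (extends? ρ) (allMaps a b) * b ^ definedCount ρ ≡ b ^ a
count-extensions zero b [] = refl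
count-extensions (suc a) b (m ∷ ρ) =
  trans (cong (_* b ^ definedCount (m ∷ ρ)) (trans (count-concatMap (extends? (m ∷ ρ)) (λ x → map (x ∷_) (allMaps a b)) (allFin b))
                                                   (∑-cong (allFin b) (λ {x} _ → count-map (extends? (m ∷ ρ)) (x ∷_) (allMaps a b)))))
        (by-head m)
  where
  c = count (extends? ρ) (allMaps a b)
  IH : c * b ^ definedCount ρ ≡ b ^ a
  IH = count-extensions a b ρ
  by-head : ∀ m → (∑[ x ∈ allFin b ] count (λ f → extends? (m ∷ ρ) (x ∷ f)) (allMaps a b)) * b ^ definedCount (m ∷ ρ) ≡ b ^ suc a
  by-head nothing = begin
    (∑[ x ∈ allFin b ] c) * b ^ definedCount ρ     ≡⟨ cong (_* b ^ definedCount ρ) (trans (∑-const c (allFin b)) (cong (_* c) (length-allFin b))) ⟩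
    (b * c) * b ^ definedCount ρ                   ≡⟨ *-assoc b c _ ⟩
    b * (c * b ^ definedCount ρ)                   ≡⟨ cong (b *_) IH ⟩
    b * b ^ a                                      ∎
    where open ≡-Reasoning
  by-head (just α) = begin
    (∑[ x ∈ allFin b ] count (λ f → (x Fin.≟ α) ×-dec extends? ρ f) (allMaps a b)) * (b * b ^ definedCount ρ)
      ≡⟨ cong (_* (b * b ^ definedCount ρ))
              (∑-cong (allFin b) (λ {x} _ → trans (count-const×-dec (x Fin.≟ α) (extends? ρ) (allMaps a b)) (*-comm _ c))) ⟩
    (∑[ x ∈ allFin b ] (c * indicator (x Fin.≟ α))) * (b * b ^ definedCount ρ)
      ≡⟨ cong (_* (b * b ^ definedCount ρ))
              (trans (∑-cong (allFin b) (λ {x} _ → cong (c *_) (indicator-sym x))) (∑-select Fin._≟_ (λ _ → c) (Unique.allFin⁺ b) (∈-allFin α))) ⟩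
    c * (b * b ^ definedCount ρ)
      ≡⟨ trans (sym (*-assoc c b _)) (trans (cong (_* b ^ definedCount ρ) (*-comm c b)) (*-assoc b c _)) ⟩
    b * (c * b ^ definedCount ρ)
      ≡⟨ cong (b *_) IH ⟩
    b * b ^ a
      ∎
    where
    open ≡-Reasoning
    indicator-sym : ∀ x → indicator (x Fin.≟ α) ≡ indicator (α Fin.≟ x)
    indicator-sym x with x Fin.≟ α | α Fin.≟ x
    ... | yes _ | yes _ = refl
    ... | yes x≡α | no α≢x = ⊥-elim (α≢x (sym x≡α))
    ... | no x≢α | yes α≡x = ⊥-elim (x≢α (sym α≡x))
    ... | no _ | no _ = refl

extends⇒ : ∀ {a b} (ρ : Vec (Maybe (Fin b)) a) f → Extends ρ f → ∀ j {α} → lookup ρ j ≡ just α → lookup f j ≡ α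
extends⇒ (just α ∷ ρ) (x ∷ f) (x≡α , _) Fin.zero refl = x≡α
extends⇒ (nothing ∷ ρ) (x ∷ f) ext (Fin.suc j) eq = extends⇒ ρ f ext j eq
extends⇒ (just α ∷ ρ) (x ∷ f) (_ , ext) (Fin.suc j) eq = extends⇒ ρ f ext j eq

extends⇐ : ∀ {a b} (ρ : Vec (Maybe (Fin b)) a) f → (∀ j {α} → lookup ρ j ≡ just α → lookup f j ≡ α) → Extends ρ f
extends⇐ [] [] _ = tt
extends⇐ (nothing ∷ ρ) (x ∷ f) agrees = extends⇐ ρ f (agrees ∘ Fin.suc)
extends⇐ (just α ∷ ρ) (x ∷ f) agrees = agrees Fin.zero refl , extends⇐ ρ f (agrees ∘ Fin.suc)

definedCount-tabulate : ∀ {a b} (h : Fin a → Maybe (Fin b)) → definedCount (tabulate h) ≡ count (λ j → T? (Maybe.is-just (h j))) (allFin a)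
definedCount-tabulate {zero} h = refl
definedCount-tabulate {suc a} h = begin
  definedCount (tabulate h)                                   ≡⟨ by-head (h Fin.zero) ⟩
  head + definedCount (tabulate (h ∘ Fin.suc))                ≡⟨ cong (head +_) (definedCount-tabulate (h ∘ Fin.suc)) ⟩
  head + count (isJust? ∘ Fin.suc) (allFin a)                 ≡⟨ cong (head +_) (count-map isJust? Fin.suc (allFin a)) ⟨
  head + count isJust? (map Fin.suc (allFin a))               ≡⟨ cong (λ js → head + count isJust? js) (List.map-tabulate id Fin.suc) ⟩
  head + count isJust? (Data.List.tabulate Fin.suc)           ≡⟨ count-∷ isJust? Fin.zero (Data.List.tabulate Fin.suc) ⟨
  count isJust? (allFin (suc a))                              ∎
  where
  open ≡-Reasoning
  isJust? = λ j → T? (Maybe.is-just (h j))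
  head = indicator (isJust? Fin.zero)
  by-head : ∀ m → definedCount (m ∷ tabulate (h ∘ Fin.suc)) ≡ indicator (T? (Maybe.is-just m)) + definedCount (tabulate (h ∘ Fin.suc))
  by-head nothing = refl
  by-head (just _) = refl

module _ {a b : ℕ} where

  valueIn : List (Fin a × Fin b) → Fin a → Maybe (Fin b)
  valueIn [] j = nothing
  valueIn ((i , α) ∷ cs) j with i Fin.≟ j
  ... | yes _ = just α
  ... | no _ = valueIn cs j

  valueIn⇒∈ : ∀ cs j {α} → valueIn cs j ≡ just α → (j , α) ∈ cs
  valueIn⇒∈ ((i , β) ∷ cs) j eq with i Fin.≟ j
  valueIn⇒∈ ((i , β) ∷ cs) j refl | yes refl = here refl
  ... | no _ = there (valueIn⇒∈ cs j eq)

  ∈⇒valueIn : ∀ {cs} → Unique (map proj₁ cs) → ∀ {j α} → (j , α) ∈ cs → valueIn cs j ≡ just α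
  ∈⇒valueIn {(i , β) ∷ cs} (i∉ ∷ u) (here refl) with i Fin.≟ i
  ... | yes _ = refl
  ... | no i≢i = ⊥-elim (i≢i refl)
  ∈⇒valueIn {(i , β) ∷ cs} (i∉ ∷ u) {j} (there jα∈) with i Fin.≟ j
  ... | yes refl = ⊥-elim (All.lookup i∉ (∈-map⁺ proj₁ jα∈) refl)
  ... | no _ = ∈⇒valueIn u jα∈

  valueIn-defined⇒∈ : ∀ cs j → T (Maybe.is-just (valueIn cs j)) → j ∈ map proj₁ cs
  valueIn-defined⇒∈ ((i , β) ∷ cs) j defined with i Fin.≟ j
  ... | yes refl = here refl
  ... | no _ = there (valueIn-defined⇒∈ cs j defined)

  prescribe : List (Fin a × Fin b) → Vec (Maybe (Fin b)) a
  prescribe cs = tabulate (valueIn cs)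

  definedCount-prescribe : ∀ {cs} → Unique (map proj₁ cs) → definedCount (prescribe cs) ≡ length cs
  definedCount-prescribe {cs} u = begin
    definedCount (prescribe cs)                         ≡⟨ definedCount-tabulate (valueIn cs) ⟩
    count defined? (allFin a)                           ≡⟨ unique-length-≡ (Unique.filter⁺ defined? (Unique.allFin⁺ a)) u
                                                             (λ {j} j∈ → valueIn-defined⇒∈ cs j (proj₂ (∈-filter⁻ defined? {xs = allFin a} j∈))) ⊇positions ⟩
    length (map proj₁ cs)                               ≡⟨ length-map proj₁ cs ⟩
    length cs                                           ∎
    where
    open ≡-Reasoning
    defined? = λ j → T? (Maybe.is-just (valueIn cs j))
    ⊇positions : ∀ {j} → j ∈ map proj₁ cs → j ∈ filter defined? (allFin a)
    ⊇positions j∈ with ∈-map⁻ proj₁ j∈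
    ... | (j , α) , jα∈ , refl = ∈-filter⁺ defined? (∈-allFin j) (subst (T ∘ Maybe.is-just) (sym (∈⇒valueIn u jα∈)) tt)

  extends-prescribe⇒ : ∀ {cs} → Unique (map proj₁ cs) → ∀ f → Extends (prescribe cs) f → ∀ {j α} → (j , α) ∈ cs → lookup f j ≡ α
  extends-prescribe⇒ {cs} u f ext {j} jα∈ = extends⇒ (prescribe cs) f ext j (trans (lookup∘tabulate (valueIn cs) j) (∈⇒valueIn u jα∈))

  extends-prescribe⇐ : ∀ cs f → (∀ {j α} → (j , α) ∈ cs → lookup f j ≡ α) → Extends (prescribe cs) f
  extends-prescribe⇐ cs f agrees = extends⇐ (prescribe cs) f (λ j eq → agrees (valueIn⇒∈ cs j (trans (sym (lookup∘tabulate (valueIn cs) j)) eq)))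

count-by-observation : {A T : Set} (_≟T_ : DecidableEquality T) (g : A → T) (xs : List A) {ts : List T} → Unique ts →
  (∀ t → t ∈ ts) → (m total : ℕ) → (∀ t → count (λ x → g x ≟T t) xs * m ≡ total) →
  ∀ {R : Pred T 0ℓ} (R? : Decidable R) → count (R? ∘ g) xs * m ≡ count R? ts * total
count-by-observation _≟T_ g xs {ts} uts complete m total fibre R? = begin
  count (R? ∘ g) xs * m
    ≡⟨ cong (_* m) (count-by-value _≟T_ g R? uts xs (λ _ → complete _)) ⟩
  (∑[ t ∈ ts ] (indicator (R? t) * count (λ x → g x ≟T t) xs)) * m
    ≡⟨ ∑-*ʳ _ ts m ⟩
  ∑[ t ∈ ts ] (indicator (R? t) * count (λ x → g x ≟T t) xs * m)
    ≡⟨ ∑-cong ts (λ {t} _ → trans (*-assoc (indicator (R? t)) _ m) (cong (indicator (R? t) *_) (fibre t))) ⟩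
  ∑[ t ∈ ts ] (indicator (R? t) * total)
    ≡⟨ ∑-*ʳ (indicator ∘ R?) ts total ⟨
  (∑[ t ∈ ts ] indicator (R? t)) * total
    ≡⟨ cong (_* total) (∑-indicator R? ts) ⟩
  count R? ts * total
    ∎
  where open ≡-Reasoning

-- Each of the b^m value tuples at m distinct points is taken by exactly b^(a−m) of the maps Fin a → Fin b.
count-maps-by-values : ∀ {a b m} {T : Set} (_≟T_ : DecidableEquality T) (g : Vec (Fin b) a → T) {ts : List T} → Unique ts →
  (∀ t → t ∈ ts) → (cs : T → List (Fin a × Fin b)) → (∀ t → Unique (map proj₁ (cs t))) → (∀ t → length (cs t) ≡ m) →
  (∀ f t → g f ≡ t → ∀ {j α} → (j , α) ∈ cs t → lookup f j ≡ α) →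
  (∀ f t → (∀ {j α} → (j , α) ∈ cs t → lookup f j ≡ α) → g f ≡ t) →
  ∀ {R : Pred T 0ℓ} (R? : Decidable R) → count (R? ∘ g) (allMaps a b) * b ^ m ≡ count R? ts * b ^ a
count-maps-by-values {a} {b} {m} _≟T_ g uts complete cs unique-positions length-cs g≡⇒ ⇒g≡ =
  count-by-observation _≟T_ g (allMaps a b) uts complete (b ^ m) (b ^ a) fibre
  where
  fibre : ∀ t → count (λ f → g f ≟T t) (allMaps a b) * b ^ m ≡ b ^ a
  fibre t = begin
    count (λ f → g f ≟T t) (allMaps a b) * b ^ m
      ≡⟨ cong₂ (λ c e → c * b ^ e)
               (count-≐ (λ f → g f ≟T t) (extends? (prescribe (cs t)))
                        (λ {f} eq → extends-prescribe⇐ (cs t) f (g≡⇒ f t eq))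
                        (λ {f} ext → ⇒g≡ f t (extends-prescribe⇒ (unique-positions t) f ext))
                        (allMaps a b))
               (trans (sym (length-cs t)) (sym (definedCount-prescribe (unique-positions t)))) ⟩
    count (extends? (prescribe (cs t))) (allMaps a b) * b ^ definedCount (prescribe (cs t))
      ≡⟨ count-extensions a b (prescribe (cs t)) ⟩
    b ^ a
      ∎
    where open ≡-Reasoning

module _ {N : ℕ} where

  Fin² = Fin N × Fin N

  _≟²_ : DecidableEquality Fin²
  _≟²_ = ×-≡-dec Fin._≟_ Fin._≟_

  all² : List Fin²
  all² = cartesianProduct (allFin N) (allFin N)

  all²-unique : Unique all²
  all²-unique = Unique.cartesianProduct⁺ (Unique.allFin⁺ N) (Unique.allFin⁺ N)

  all²-complete : ∀ t → t ∈ all²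
  all²-complete (x , y) = ∈-cartesianProduct⁺ (∈-allFin x) (∈-allFin y)

  count-by-values₂ : ∀ x y → x ≢ y → ∀ {R : Pred Fin² 0ℓ} (R? : Decidable R) →
    count (λ f → R? (lookup f x , lookup f y)) (allMaps N N) * N ^ 2 ≡ count R? all² * N ^ N
  count-by-values₂ x y x≢y =
    count-maps-by-values _≟²_ (λ f → lookup f x , lookup f y) all²-unique all²-complete
      (λ { (α , β) → (x , α) ∷ (y , β) ∷ [] }) (λ _ → (x≢y ∷ []) ∷ [] ∷ []) (λ _ → refl)
      (λ { f _ refl (here refl) → refl ; f _ refl (there (here refl)) → refl })
      (λ f _ agrees → cong₂ _,_ (agrees (here refl)) (agrees (there (here refl))))

  count-by-values₃ : ∀ x y z → x ≢ y → x ≢ z → y ≢ z → ∀ {R : Pred (Fin N × Fin²) 0ℓ} (R? : Decidable R) →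
    count (λ f → R? (lookup f x , (lookup f y , lookup f z))) (allMaps N N) * N ^ 3 ≡ count R? (cartesianProduct (allFin N) all²) * N ^ N
  count-by-values₃ x y z x≢y x≢z y≢z =
    count-maps-by-values (×-≡-dec Fin._≟_ _≟²_) (λ f → lookup f x , (lookup f y , lookup f z))
      (Unique.cartesianProduct⁺ (Unique.allFin⁺ N) all²-unique) (λ { (α , t) → ∈-cartesianProduct⁺ (∈-allFin α) (all²-complete t) })
      (λ { (α , (β , γ)) → (x , α) ∷ (y , β) ∷ (z , γ) ∷ [] }) (λ _ → (x≢y ∷ x≢z ∷ []) ∷ (y≢z ∷ []) ∷ [] ∷ []) (λ _ → refl)
      (λ { f _ refl (here refl) → refl ; f _ refl (there (here refl)) → refl ; f _ refl (there (there (here refl))) → refl })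
      (λ f _ agrees → cong₂ _,_ (agrees (here refl)) (cong₂ _,_ (agrees (there (here refl))) (agrees (there (there (here refl))))))

  count-by-values₄ : ∀ x₁ y₁ x₂ y₂ → x₁ ≢ y₁ → x₁ ≢ x₂ → x₁ ≢ y₂ → y₁ ≢ x₂ → y₁ ≢ y₂ → x₂ ≢ y₂ →
    ∀ {R : Pred (Fin² × Fin²) 0ℓ} (R? : Decidable R) →
    count (λ f → R? ((lookup f x₁ , lookup f y₁) , (lookup f x₂ , lookup f y₂))) (allMaps N N) * N ^ 4 ≡ count R? (cartesianProduct all² all²) * N ^ N
  count-by-values₄ x₁ y₁ x₂ y₂ x₁≢y₁ x₁≢x₂ x₁≢y₂ y₁≢x₂ y₁≢y₂ x₂≢y₂ =
    count-maps-by-values (×-≡-dec _≟²_ _≟²_) (λ f → (lookup f x₁ , lookup f y₁) , (lookup f x₂ , lookup f y₂))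
      (Unique.cartesianProduct⁺ all²-unique all²-unique) (λ { (t , t′) → ∈-cartesianProduct⁺ (all²-complete t) (all²-complete t′) })
      (λ { ((α , β) , (γ , δ)) → (x₁ , α) ∷ (y₁ , β) ∷ (x₂ , γ) ∷ (y₂ , δ) ∷ [] })
      (λ _ → (x₁≢y₁ ∷ x₁≢x₂ ∷ x₁≢y₂ ∷ []) ∷ (y₁≢x₂ ∷ y₁≢y₂ ∷ []) ∷ (x₂≢y₂ ∷ []) ∷ [] ∷ []) (λ _ → refl)
      (λ { f _ refl (here refl) → refl ; f _ refl (there (here refl)) → refl
         ; f _ refl (there (there (here refl))) → refl ; f _ refl (there (there (there (here refl)))) → refl })
      (λ f _ agrees → cong₂ _,_ (cong₂ _,_ (agrees (here refl)) (agrees (there (here refl))))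
                                (cong₂ _,_ (agrees (there (there (here refl)))) (agrees (there (there (there (here refl)))))))

homCount : Graph → ℕ
homCount G = selfHomCount G {Q = λ _ → ⊤} (λ _ → yes tt)

,≢ˡ : {A B : Set} {a a′ : A} {b b′ : B} → a ≢ a′ → (a , b) ≢ (a′ , b′)
,≢ˡ a≢a′ refl = a≢a′ refl

,≢ʳ : {A B : Set} {a a′ : A} {b b′ : B} → b ≢ b′ → (a , b) ≢ (a′ , b′)
,≢ʳ b≢b′ refl = b≢b′ refl

record EdgeShape (G : Graph) : Set where
  field
    w p : Fin (n G)
    wp : E G w p
    edges : ∀ {u v} → E G u v → (u , v) ∈ (w , p) ∷ (p , w) ∷ []

record PathShape (G : Graph) : Set where
  field
    x y z : Fin (n G)
    x≢z : x ≢ z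
    xy : E G x y
    yz : E G y z
    edges : ∀ {u v} → E G u v → (u , v) ∈ (x , y) ∷ (y , x) ∷ (y , z) ∷ (z , y) ∷ []

record MatchingShape (G : Graph) : Set where
  field
    x₁ y₁ x₂ y₂ : Fin (n G)
    x₁≢x₂ : x₁ ≢ x₂
    x₁≢y₂ : x₁ ≢ y₂
    y₁≢x₂ : y₁ ≢ x₂
    y₁≢y₂ : y₁ ≢ y₂
    x₁y₁ : E G x₁ y₁
    x₂y₂ : E G x₂ y₂
    edges : ∀ {u v} → E G u v → (u , v) ∈ (x₁ , y₁) ∷ (y₁ , x₁) ∷ (x₂ , y₂) ∷ (y₂ , x₂) ∷ []

module _ (G : Graph) where

  private
    N = n G

  OrderedEdge : Pred (Fin N × Fin N) 0ℓ
  OrderedEdge (u , v) = E G u v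

  orderedEdge? : Decidable OrderedEdge
  orderedEdge? (u , v) = E? G u v

  homCount-≐ : {P : Pred (Vec (Fin N) N) 0ℓ} (P? : Decidable P) →
    (∀ {f} → IsHom G G f → P f) → (∀ f → P f → IsHom G G f) → homCount G ≡ count P? (allMaps N N)
  homCount-≐ P? hom⇒P P⇒hom = count-≐ _ P? (hom⇒P ∘ proj₁) (λ {f} Pf → P⇒hom f Pf , tt) (allMaps N N)

  count-orderedEdges : {es : List (Fin N × Fin N)} → Unique es → (∀ {u v} → E G u v → (u , v) ∈ es) →
    (∀ {t} → t ∈ es → OrderedEdge t) → count orderedEdge? all² ≡ length es
  count-orderedEdges ues edges⊆ ⊆edges = count-≡-length orderedEdge? all²-unique all²-complete ues edges⊆ ⊆edges

  edgeShape⇒homCount : EdgeShape G → homCount G * N ^ 2 ≡ 2 * N ^ N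
  edgeShape⇒homCount shape = begin
    homCount G * N ^ 2
      ≡⟨ cong (_* N ^ 2) (homCount-≐ (λ f → orderedEdge? (lookup f w , lookup f p)) (λ isHom → isHom w p wp) hom) ⟩
    count (λ f → orderedEdge? (lookup f w , lookup f p)) (allMaps N N) * N ^ 2
      ≡⟨ count-by-values₂ w p (E⇒≢ G wp) orderedEdge? ⟩
    count orderedEdge? all² * N ^ N
      ≡⟨ cong (_* N ^ N) (count-orderedEdges ((,≢ˡ (E⇒≢ G wp) ∷ []) ∷ [] ∷ []) edges
                                             (λ { (here refl) → wp ; (there (here refl)) → E-sym G wp })) ⟩
    2 * N ^ N
      ∎
    where
    open ≡-Reasoning
    open EdgeShape shape
    hom : ∀ f → E G (lookup f w) (lookup f p) → IsHom G G f
    hom f fwp u v uv with edges uv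
    ... | here refl = fwp
    ... | there (here refl) = E-sym G fwp

  matchingShape⇒homCount : MatchingShape G → homCount G * N ^ 4 ≡ 16 * N ^ N
  matchingShape⇒homCount shape = begin
    homCount G * N ^ 4
      ≡⟨ cong (_* N ^ 4) (homCount-≐ (λ f → R? (observe f)) (λ isHom → isHom x₁ y₁ x₁y₁ , isHom x₂ y₂ x₂y₂) hom) ⟩
    count (λ f → R? (observe f)) (allMaps N N) * N ^ 4
      ≡⟨ count-by-values₄ x₁ y₁ x₂ y₂ (E⇒≢ G x₁y₁) x₁≢x₂ x₁≢y₂ y₁≢x₂ y₁≢y₂ (E⇒≢ G x₂y₂) R? ⟩
    count R? (cartesianProduct all² all²) * N ^ N
      ≡⟨ cong (_* N ^ N) (trans (count-cartesianProduct orderedEdge? orderedEdge? all² all²) (cong₂ _*_ four four)) ⟩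
    16 * N ^ N
      ∎
    where
    open ≡-Reasoning
    open MatchingShape shape
    observe : Vec (Fin N) N → (Fin N × Fin N) × (Fin N × Fin N)
    observe f = (lookup f x₁ , lookup f y₁) , (lookup f x₂ , lookup f y₂)
    R? : Decidable (λ (t : (Fin N × Fin N) × (Fin N × Fin N)) → OrderedEdge (proj₁ t) × OrderedEdge (proj₂ t))
    R? t = orderedEdge? (proj₁ t) ×-dec orderedEdge? (proj₂ t)
    hom : ∀ f → OrderedEdge (proj₁ (observe f)) × OrderedEdge (proj₂ (observe f)) → IsHom G G f
    hom f (f₁ , f₂) u v uv with edges uv
    ... | here refl = f₁
    ... | there (here refl) = E-sym G f₁
    ... | there (there (here refl)) = f₂
    ... | there (there (there (here refl))) = E-sym G f₂
    x₁≢y₁ = E⇒≢ G x₁y₁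
    x₂≢y₂ = E⇒≢ G x₂y₂
    four : count orderedEdge? all² ≡ 4
    four = count-orderedEdges
      ((,≢ˡ x₁≢y₁ ∷ ,≢ˡ x₁≢x₂ ∷ ,≢ˡ x₁≢y₂ ∷ []) ∷ (,≢ˡ y₁≢x₂ ∷ ,≢ˡ y₁≢y₂ ∷ []) ∷ (,≢ˡ x₂≢y₂ ∷ []) ∷ [] ∷ []) edges
      (λ { (here refl) → x₁y₁ ; (there (here refl)) → E-sym G x₁y₁
         ; (there (there (here refl))) → x₂y₂ ; (there (there (there (here refl)))) → E-sym G x₂y₂ })

  Walk₂ : Pred (Fin N × (Fin N × Fin N)) 0ℓ
  Walk₂ (α , (β , γ)) = E G α β × E G β γ

  walk₂? : Decidable Walk₂
  walk₂? (α , (β , γ)) = E? G α β ×-dec E? G β γ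

  pathShape⇒count-walks₂ : PathShape G → count walk₂? (cartesianProduct (allFin N) all²) ≡ 6
  pathShape⇒count-walks₂ shape = count-≡-length walk₂? (Unique.cartesianProduct⁺ (Unique.allFin⁺ N) all²-unique)
    (λ { (α , t) → ∈-cartesianProduct⁺ (∈-allFin α) (all²-complete t) }) walks-unique walk⇒∈ ∈⇒walk
    where
    open PathShape shape
    x≢y = E⇒≢ G xy
    y≢z = E⇒≢ G yz
    walks : List (Fin N × (Fin N × Fin N))
    walks = (x , (y , x)) ∷ (x , (y , z)) ∷ (z , (y , x)) ∷ (z , (y , z)) ∷ (y , (x , y)) ∷ (y , (z , y)) ∷ []
    walks-unique : Unique walks
    walks-unique =
      (,≢ʳ (,≢ʳ x≢z) ∷ ,≢ˡ x≢z ∷ ,≢ˡ x≢z ∷ ,≢ˡ x≢y ∷ ,≢ˡ x≢y ∷ [])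
      ∷ (,≢ˡ x≢z ∷ ,≢ˡ x≢z ∷ ,≢ˡ x≢y ∷ ,≢ˡ x≢y ∷ [])
      ∷ (,≢ʳ (,≢ʳ x≢z) ∷ ,≢ˡ (≢-sym y≢z) ∷ ,≢ˡ (≢-sym y≢z) ∷ [])
      ∷ (,≢ˡ (≢-sym y≢z) ∷ ,≢ˡ (≢-sym y≢z) ∷ [])
      ∷ (,≢ʳ (,≢ˡ x≢z) ∷ [])
      ∷ [] ∷ []
    ∈⇒walk : ∀ {t} → t ∈ walks → Walk₂ t
    ∈⇒walk (here refl) = xy , E-sym G xy
    ∈⇒walk (there (here refl)) = xy , yz
    ∈⇒walk (there (there (here refl))) = E-sym G yz , E-sym G xy
    ∈⇒walk (there (there (there (here refl)))) = E-sym G yz , yz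
    ∈⇒walk (there (there (there (there (here refl))))) = E-sym G xy , xy
    ∈⇒walk (there (there (there (there (there (here refl)))))) = yz , E-sym G yz
    Edges = (x , y) ∷ (y , x) ∷ (y , z) ∷ (z , y) ∷ []
    through : ∀ {α β γ} → (α , β) ∈ Edges → (β , γ) ∈ Edges → (α , (β , γ)) ∈ walks
    through (here refl) (here eq) = ⊥-elim (x≢y (sym (cong proj₁ eq)))
    through (here refl) (there (here refl)) = here refl
    through (here refl) (there (there (here refl))) = there (here refl)
    through (here refl) (there (there (there (here eq)))) = ⊥-elim (y≢z (cong proj₁ eq))
    through (there (here refl)) (here refl) = there (there (there (there (here refl))))
    through (there (here refl)) (there (here eq)) = ⊥-elim (x≢y (cong proj₁ eq))
    through (there (here refl)) (there (there (here eq))) = ⊥-elim (x≢y (cong proj₁ eq))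
    through (there (here refl)) (there (there (there (here eq)))) = ⊥-elim (x≢z (cong proj₁ eq))
    through (there (there (here refl))) (here eq) = ⊥-elim (x≢z (sym (cong proj₁ eq)))
    through (there (there (here refl))) (there (here eq)) = ⊥-elim (y≢z (sym (cong proj₁ eq)))
    through (there (there (here refl))) (there (there (here eq))) = ⊥-elim (y≢z (sym (cong proj₁ eq)))
    through (there (there (here refl))) (there (there (there (here refl)))) = there (there (there (there (there (here refl)))))
    through (there (there (there (here refl)))) (here eq) = ⊥-elim (x≢y (sym (cong proj₁ eq)))
    through (there (there (there (here refl)))) (there (here refl)) = there (there (here refl))
    through (there (there (there (here refl)))) (there (there (here refl))) = there (there (there (here refl)))
    through (there (there (there (here refl)))) (there (there (there (here eq)))) = ⊥-elim (y≢z (cong proj₁ eq))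
    walk⇒∈ : ∀ {t} → Walk₂ t → t ∈ walks
    walk⇒∈ (αβ , βγ) = through (edges αβ) (edges βγ)

  pathShape⇒homCount : PathShape G → homCount G * N ^ 3 ≡ 6 * N ^ N
  pathShape⇒homCount shape = begin
    homCount G * N ^ 3
      ≡⟨ cong (_* N ^ 3) (homCount-≐ (walk₂? ∘ observe) (λ isHom → isHom x y xy , isHom y z yz) hom) ⟩
    count (walk₂? ∘ observe) (allMaps N N) * N ^ 3
      ≡⟨ count-by-values₃ x y z (E⇒≢ G xy) x≢z (E⇒≢ G yz) walk₂? ⟩
    count walk₂? (cartesianProduct (allFin N) all²) * N ^ N
      ≡⟨ cong (_* N ^ N) (pathShape⇒count-walks₂ shape) ⟩
    6 * N ^ N
      ∎
    where
    open ≡-Reasoning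
    open PathShape shape
    observe : Vec (Fin N) N → Fin N × (Fin N × Fin N)
    observe f = lookup f x , (lookup f y , lookup f z)
    hom : ∀ f → Walk₂ (observe f) → IsHom G G f
    hom f (fxy , fyz) u v uv with edges uv
    ... | here refl = fxy
    ... | there (here refl) = E-sym G fxy
    ... | there (there (here refl)) = fyz
    ... | there (there (there (here refl))) = E-sym G fyz

  twoEdges⇒shape : ∀ w₁ p₁ w₂ p₂ → w₁ ≢ w₂ → (p₁ ≡ w₂ → p₂ ≡ w₁ → ⊥) → E G w₁ p₁ → E G w₂ p₂ →
    (∀ {u v} → E G u v → (u , v) ∈ (w₁ , p₁) ∷ (p₁ , w₁) ∷ (w₂ , p₂) ∷ (p₂ , w₂) ∷ []) → PathShape G ⊎ MatchingShape G
  twoEdges⇒shape w₁ p₁ w₂ p₂ w₁≢w₂ ¬2-cycle w₁p₁ w₂p₂ edges with p₁ Fin.≟ w₂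
  ... | yes refl =
    inj₁ (record { x = w₁ ; y = p₁ ; z = p₂ ; x≢z = λ w₁≡p₂ → ¬2-cycle refl (sym w₁≡p₂) ; xy = w₁p₁ ; yz = w₂p₂ ; edges = edges })
  ... | no p₁≢w₂ with p₂ Fin.≟ w₁
  ...   | yes refl = inj₁ (record { x = w₂ ; y = p₂ ; z = p₁ ; x≢z = ≢-sym p₁≢w₂ ; xy = w₂p₂ ; yz = w₁p₁ ; edges = edges′ })
    where
    edges′ : ∀ {u v} → E G u v → (u , v) ∈ (w₂ , p₂) ∷ (p₂ , w₂) ∷ (p₂ , p₁) ∷ (p₁ , p₂) ∷ []
    edges′ uv with edges uv
    ... | here refl = there (there (here refl))
    ... | there (here refl) = there (there (there (here refl)))
    ... | there (there (here refl)) = here refl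
    ... | there (there (there (here refl))) = there (here refl)
  ...   | no p₂≢w₁ with p₁ Fin.≟ p₂
  ...     | yes refl = inj₁ (record { x = w₁ ; y = p₁ ; z = w₂ ; x≢z = w₁≢w₂ ; xy = w₁p₁ ; yz = E-sym G w₂p₂ ; edges = edges′ })
    where
    edges′ : ∀ {u v} → E G u v → (u , v) ∈ (w₁ , p₁) ∷ (p₁ , w₁) ∷ (p₁ , w₂) ∷ (w₂ , p₁) ∷ []
    edges′ uv with edges uv
    ... | here refl = here refl
    ... | there (here refl) = there (here refl)
    ... | there (there (here refl)) = there (there (there (here refl)))
    ... | there (there (there (here refl))) = there (there (here refl))
  ...     | no p₁≢p₂ = inj₂ (record { x₁ = w₁ ; y₁ = p₁ ; x₂ = w₂ ; y₂ = p₂ ; x₁≢x₂ = w₁≢w₂ ; x₁≢y₂ = ≢-sym p₂≢w₁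
                                   ; y₁≢x₂ = p₁≢w₂ ; y₁≢y₂ = p₁≢p₂ ; x₁y₁ = w₁p₁ ; x₂y₂ = w₂p₂ ; edges = edges })

≅-from-inverses : (G H : Graph) (to : Fin (n G) → Fin (n H)) (from : Fin (n H) → Fin (n G)) →
  (∀ i → to (from i) ≡ i) → (∀ v → from (to v) ≡ v) → (∀ i j → adj G (from i) (from j) ≡ adj H i j) → G ≅ H
≅-from-inverses G H to from to∘from from∘to adj-from =
  mk↔ₛ′ to from to∘from from∘to , λ u v → trans (cong₂ (adj G) (sym (from∘to u)) (sym (from∘to v))) (adj-from (to u) (to v))

non-edge : (G : Graph) {u v : Fin (n G)} {es : List (Fin (n G) × Fin (n G))} →
  (∀ {u′ v′} → E G u′ v′ → (u′ , v′) ∈ es) → All ((u , v) ≢_) es → adj G u v ≡ false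
non-edge G edges uv∉ = ¬-not λ uv → All.lookup uv∉ (edges uv) refl

third-vertex : (G : Graph) → n G ≡ 3 → ∀ {a b} → a ≢ b → Σ (Fin (n G)) λ c → c ≢ a × c ≢ b
third-vertex G three {a} {b} a≢b with Finₚ.any? {n = n G} (λ c → ¬? (c Fin.≟ a) ×-dec ¬? (c Fin.≟ b))
... | yes found = found
... | no none = ⊥-elim (<-irrefl refl (subst (_≤ 2) (trans (length-allFin (n G)) three)
                   (unique-length-≤ {ys = a ∷ b ∷ []} (Unique.allFin⁺ (n G)) (λ {c} _ → a-or-b c))))
  where
  a-or-b : ∀ c → c ∈ a ∷ b ∷ []
  a-or-b c with c Fin.≟ a | c Fin.≟ b
  ... | yes refl | _ = here refl
  ... | no _ | yes refl = there (here refl)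
  ... | no c≢a | no c≢b = ⊥-elim (none (c , c≢a , c≢b))

module OnThreeVertices (G : Graph) (three : n G ≡ 3) {a b c : Fin (n G)} (a≢b : a ≢ b) (a≢c : a ≢ c) (b≢c : b ≢ c) where

  exhaustive : ∀ v → v ≢ a → v ≢ b → v ≡ c
  exhaustive v v≢a v≢b with v Fin.≟ c
  ... | yes v≡c = v≡c
  ... | no v≢c = ⊥-elim (<-irrefl refl (subst (4 ≤_) (trans (length-allFin (n G)) three)
                    (unique-length-≤ {xs = v ∷ a ∷ b ∷ c ∷ []} ((v≢a ∷ v≢b ∷ v≢c ∷ []) ∷ (a≢b ∷ a≢c ∷ []) ∷ (b≢c ∷ []) ∷ [] ∷ [])
                                     (λ {u} _ → ∈-allFin u))))

  fromFin3 : Fin 3 → Fin (n G)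
  fromFin3 Fin.zero = a
  fromFin3 (Fin.suc Fin.zero) = b
  fromFin3 (Fin.suc (Fin.suc Fin.zero)) = c

  toFin3 : Fin (n G) → Fin 3
  toFin3 v with v Fin.≟ a | v Fin.≟ b
  ... | yes _ | _ = Fin.zero
  ... | no _ | yes _ = Fin.suc Fin.zero
  ... | no _ | no _ = Fin.suc (Fin.suc Fin.zero)

  toFin3∘fromFin3 : ∀ i → toFin3 (fromFin3 i) ≡ i
  toFin3∘fromFin3 Fin.zero with a Fin.≟ a
  ... | yes _ = refl
  ... | no a≢a = ⊥-elim (a≢a refl)
  toFin3∘fromFin3 (Fin.suc Fin.zero) with b Fin.≟ a | b Fin.≟ b
  ... | yes b≡a | _ = ⊥-elim (a≢b (sym b≡a))
  ... | no _ | yes _ = refl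
  ... | no _ | no b≢b = ⊥-elim (b≢b refl)
  toFin3∘fromFin3 (Fin.suc (Fin.suc Fin.zero)) with c Fin.≟ a | c Fin.≟ b
  ... | yes c≡a | _ = ⊥-elim (a≢c (sym c≡a))
  ... | no _ | yes c≡b = ⊥-elim (b≢c (sym c≡b))
  ... | no _ | no _ = refl

  fromFin3∘toFin3 : ∀ v → fromFin3 (toFin3 v) ≡ v
  fromFin3∘toFin3 v with v Fin.≟ a | v Fin.≟ b
  ... | yes v≡a | _ = sym v≡a
  ... | no _ | yes v≡b = sym v≡b
  ... | no v≢a | no v≢b = sym (exhaustive v v≢a v≢b)


edgeShape⇒≅K1⊔K2 : (G : Graph) → EdgeShape G → n G ≡ 3 → G ≅ K1⊔K2
edgeShape⇒≅K1⊔K2 G shape three with third-vertex G three (E⇒≢ G (EdgeShape.wp shape))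
... | t , t≢w , t≢p = ≅-from-inverses G K1⊔K2 toFin3 fromFin3 toFin3∘fromFin3 fromFin3∘toFin3 table
  where
  open EdgeShape shape
  open OnThreeVertices G three t≢w t≢p (E⇒≢ G wp)
  table : ∀ i j → adj G (fromFin3 i) (fromFin3 j) ≡ adj K1⊔K2 i j
  table Fin.zero Fin.zero = irrefl G t
  table Fin.zero (Fin.suc Fin.zero) = non-edge G edges (,≢ˡ t≢w ∷ ,≢ˡ t≢p ∷ [])
  table Fin.zero (Fin.suc (Fin.suc Fin.zero)) = non-edge G edges (,≢ˡ t≢w ∷ ,≢ˡ t≢p ∷ [])
  table (Fin.suc Fin.zero) Fin.zero = non-edge G edges (,≢ʳ t≢p ∷ ,≢ˡ (E⇒≢ G wp) ∷ [])
  table (Fin.suc Fin.zero) (Fin.suc Fin.zero) = irrefl G w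
  table (Fin.suc Fin.zero) (Fin.suc (Fin.suc Fin.zero)) = wp
  table (Fin.suc (Fin.suc Fin.zero)) Fin.zero = non-edge G edges (,≢ˡ (≢-sym (E⇒≢ G wp)) ∷ ,≢ʳ t≢w ∷ [])
  table (Fin.suc (Fin.suc Fin.zero)) (Fin.suc Fin.zero) = E-sym G wp
  table (Fin.suc (Fin.suc Fin.zero)) (Fin.suc (Fin.suc Fin.zero)) = irrefl G p

pathShape⇒≅P3 : (G : Graph) → PathShape G → n G ≡ 3 → G ≅ P3
pathShape⇒≅P3 G shape three = ≅-from-inverses G P3 toFin3 fromFin3 toFin3∘fromFin3 fromFin3∘toFin3 table
  where
  open PathShape shape
  x≢y = E⇒≢ G xy
  y≢z = E⇒≢ G yz
  open OnThreeVertices G three x≢y x≢z y≢z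
  table : ∀ i j → adj G (fromFin3 i) (fromFin3 j) ≡ adj P3 i j
  table Fin.zero Fin.zero = irrefl G x
  table Fin.zero (Fin.suc Fin.zero) = xy
  table Fin.zero (Fin.suc (Fin.suc Fin.zero)) = non-edge G edges (,≢ʳ (≢-sym y≢z) ∷ ,≢ˡ x≢y ∷ ,≢ˡ x≢y ∷ ,≢ˡ x≢z ∷ [])
  table (Fin.suc Fin.zero) Fin.zero = E-sym G xy
  table (Fin.suc Fin.zero) (Fin.suc Fin.zero) = irrefl G y
  table (Fin.suc Fin.zero) (Fin.suc (Fin.suc Fin.zero)) = yz
  table (Fin.suc (Fin.suc Fin.zero)) Fin.zero = non-edge G edges (,≢ˡ (≢-sym x≢z) ∷ ,≢ˡ (≢-sym y≢z) ∷ ,≢ˡ (≢-sym y≢z) ∷ ,≢ʳ x≢y ∷ [])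
  table (Fin.suc (Fin.suc Fin.zero)) (Fin.suc Fin.zero) = E-sym G yz
  table (Fin.suc (Fin.suc Fin.zero)) (Fin.suc (Fin.suc Fin.zero)) = irrefl G z

module ForestInvariants (F : Graph) (forest : Forest F) {k : ℕ} (components : HasComponents F k) where
  open RootedForest F forest components public
  open HomsOntoAnEdge F forest components using (count-imageSize≡2) public

  length-nonRoots : length nonRoots ≡ n F ∸ k
  length-nonRoots = trans (sym (m+n∸n≡m (length nonRoots) k)) (cong (_∸ k) length-nonRoots+k)

  k≤n : k ≤ n F
  k≤n = subst (k ≤_) length-nonRoots+k (m≤n+m k (length nonRoots))

  edgeless⇒allRoots : n F ∸ k ≡ 0 → ∀ v → IsRoot v
  edgeless⇒allRoots none v with IsRoot? v
  ... | yes isRoot = isRoot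
  ... | no ¬root = ⊥-elim (<-irrefl (trans (sym none) (sym length-nonRoots)) (∈⇒count>0 (¬? ∘ IsRoot?) (∈-allFin v) ¬root))

  nonRoot-exists : 0 < n F ∸ k → Σ V λ w → ¬ IsRoot w
  nonRoot-exists some with count>0⇒∈ (¬? ∘ IsRoot?) (allFin (n F)) (subst (0 <_) (sym length-nonRoots) some)
  ... | w , _ , ¬root = w , ¬root

  count-imageSize≡1-nonRoot : ∀ {w} → ¬ IsRoot w → selfHomCount F (λ τ → length τ ≟ 1) ≡ 0
  count-imageSize≡1-nonRoot {w} ¬root = count-none _ (allMaps (n F) (n F)) not-constant
    where
    not-constant : ∀ {f} → f ∈ allMaps (n F) (n F) → ¬ (IsHom F F f × length (homType f) ≡ 1)
    not-constant {f} _ (isHom , size≡1) with imageSize≡1⇒ f size≡1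
    ... | x , only = E⇒≢ F (isHom w (parent w) (parent-edge ¬root)) (trans (only (w , refl)) (sym (only (parent w , refl))))

  count-imageSize≡1-allRoots : (∀ v → IsRoot v) → V → 0 < selfHomCount F (λ τ → length τ ≟ 1)
  count-imageSize≡1-allRoots allRoots v₀ = ∈⇒count>0 (λ f → IsHom? F F f ×-dec (length (homType f) ≟ 1))
    (allMaps-complete (n F) (n F) constant)
    (isHom , length-homType-≡ constant ([] ∷ []) image⊆ (λ { (here refl) → v₀ , lookup-replicate v₀ v₀ }))
    where
    constant : Vec V (n F)
    constant = replicate (n F) v₀
    isHom : IsHom F F constant
    isHom u v uv = ⊥-elim ([ (λ { (¬root , _) → ¬root (allRoots v) }) , (λ { (¬root , _) → ¬root (allRoots u) }) ] (edge⇒parent-edge uv))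
    image⊆ : ∀ {z} → InImage constant z → z ∈ v₀ ∷ []
    image⊆ (u , refl) = here (lookup-replicate u v₀)

  singleNonRoot⇒edgeShape : length nonRoots ≡ 1 → EdgeShape F
  singleNonRoot⇒edgeShape one = from-list nonRoots refl one
    where
    from-list : ∀ ws → ws ≡ nonRoots → length ws ≡ 1 → EdgeShape F
    from-list (w ∷ []) ws≡ _ = record { w = w ; p = parent w ; wp = parent-edge ¬root ; edges = edges }
      where
      ¬root : ¬ IsRoot w
      ¬root = ∈-nonRoots⁻ (subst (w ∈_) ws≡ (here refl))
      only : ∀ {v} → ¬ IsRoot v → v ≡ w
      only ¬root with subst (_ ∈_) (sym ws≡) (∈-nonRoots⁺ ¬root)
      ... | here v≡w = v≡w
      edges : ∀ {u v} → E F u v → (u , v) ∈ (w , parent w) ∷ (parent w , w) ∷ []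
      edges uv with edge⇒parent-edge uv
      ... | inj₁ (¬root , refl) with only ¬root
      ...   | refl = there (here refl)
      edges uv | inj₂ (¬root , refl) with only ¬root
      ...   | refl = here refl

  twoNonRoots⇒shape : length nonRoots ≡ 2 → PathShape F ⊎ MatchingShape F
  twoNonRoots⇒shape two = from-list nonRoots refl (Unique.filter⁺ (¬? ∘ IsRoot?) (Unique.allFin⁺ (n F))) two
    where
    from-list : ∀ ws → ws ≡ nonRoots → Unique ws → length ws ≡ 2 → PathShape F ⊎ MatchingShape F
    from-list (w₁ ∷ w₂ ∷ []) ws≡ ((w₁≢w₂ ∷ []) ∷ _) _ =
      twoEdges⇒shape F w₁ (parent w₁) w₂ (parent w₂) w₁≢w₂ (parent-no-2-cycle ¬root₁ ¬root₂) (parent-edge ¬root₁) (parent-edge ¬root₂) edges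
      where
      ¬root₁ = ∈-nonRoots⁻ (subst (w₁ ∈_) ws≡ (here refl))
      ¬root₂ = ∈-nonRoots⁻ (subst (w₂ ∈_) ws≡ (there (here refl)))
      only : ∀ {v} → ¬ IsRoot v → v ≡ w₁ ⊎ v ≡ w₂
      only ¬root with subst (_ ∈_) (sym ws≡) (∈-nonRoots⁺ ¬root)
      ... | here v≡w₁ = inj₁ v≡w₁
      ... | there (here v≡w₂) = inj₂ v≡w₂
      edges : ∀ {u v} → E F u v → (u , v) ∈ (w₁ , parent w₁) ∷ (parent w₁ , w₁) ∷ (w₂ , parent w₂) ∷ (parent w₂ , w₂) ∷ []
      edges uv with edge⇒parent-edge uv
      ... | inj₁ (¬root , refl) with only ¬root
      ...   | inj₁ refl = there (here refl)
      ...   | inj₂ refl = there (there (there (here refl)))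
      edges uv | inj₂ (¬root , refl) with only ¬root
      ...   | inj₁ refl = here refl
      ...   | inj₂ refl = there (there (here refl))

  edgeless⇒count-imageSize≡1>0 : n F ∸ k ≡ 0 → V → 0 < selfHomCount F (λ τ → length τ ≟ 1)
  edgeless⇒count-imageSize≡1>0 none = count-imageSize≡1-allRoots (edgeless⇒allRoots none)

  edge⇒count-imageSize≡1≡0 : 0 < n F ∸ k → selfHomCount F (λ τ → length τ ≟ 1) ≡ 0
  edge⇒count-imageSize≡1≡0 some = count-imageSize≡1-nonRoot (proj₂ (nonRoot-exists some))

  count-homsOntoEdges : 0 < n F ∸ k → selfHomCount F (λ τ → length τ ≟ 2) ≡ (n F ∸ k) * 2 ^ k
  count-homsOntoEdges some = trans (count-imageSize≡2 (proj₂ (nonRoot-exists some))) (cong (_* 2 ^ k) length-nonRoots)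

  oneEdge⇒edgeShape : n F ∸ k ≡ 1 → EdgeShape F
  oneEdge⇒edgeShape one = singleNonRoot⇒edgeShape (trans length-nonRoots one)

  twoEdges⇒pathOrMatching : n F ∸ k ≡ 2 → PathShape F ⊎ MatchingShape F
  twoEdges⇒pathOrMatching two = twoNonRoots⇒shape (trans length-nonRoots two)

1+n≤2^n : ∀ d → suc d ≤ 2 ^ d
1+n≤2^n zero = s≤s z≤n
1+n≤2^n (suc d) = begin
  suc (suc d)          ≤⟨ s≤s (m≤n+m (suc d) d) ⟩
  suc d + suc d        ≤⟨ +-mono-≤ (1+n≤2^n d) (1+n≤2^n d) ⟩
  2 ^ d + 2 ^ d        ≡⟨ cong (2 ^ d +_) (+-identityʳ (2 ^ d)) ⟨
  2 ^ suc d            ∎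
  where open ≤-Reasoning

2^n≡1+n⇒n≤1 : ∀ d → 2 ^ d ≡ suc d → d ≤ 1
2^n≡1+n⇒n≤1 zero _ = z≤n
2^n≡1+n⇒n≤1 (suc zero) _ = ≤-refl
2^n≡1+n⇒n≤1 (suc (suc e)) eq = ⊥-elim (<-irrefl (sym eq) (begin-strict
  suc (suc (suc e))              <⟨ s≤s (s≤s (m≤n+m (suc (suc e)) e)) ⟩
  suc (suc e) + suc (suc e)      ≤⟨ +-mono-≤ (1+n≤2^n (suc e)) (1+n≤2^n (suc e)) ⟩
  2 ^ suc e + 2 ^ suc e          ≡⟨ cong (2 ^ suc e +_) (+-identityʳ (2 ^ suc e)) ⟨
  2 ^ suc (suc e)                ∎))
  where open ≤-Reasoning

a*2^d≡a+d⇒ : ∀ {a d} → 0 < a → 0 < d → a * 2 ^ d ≡ a + d → a ≡ 1 × d ≡ 1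
a*2^d≡a+d⇒ {a} {d} 0<a 0<d eq = a≡1 , ≤-antisym (2^n≡1+n⇒n≤1 d 2^d≡1+d) 0<d
  where
  a+a*d≤a+d : a + a * d ≤ a + d
  a+a*d≤a+d = begin
    a + a * d  ≡⟨ *-suc a d ⟨
    a * suc d  ≤⟨ *-monoʳ-≤ a (1+n≤2^n d) ⟩
    a * 2 ^ d  ≡⟨ eq ⟩
    a + d      ∎
    where open ≤-Reasoning
  a≡1 : a ≡ 1
  a≡1 = ≤-antisym (*-cancelʳ-≤ a 1 d {{>-nonZero 0<d}} (≤-trans (+-cancelˡ-≤ a _ _ a+a*d≤a+d) (≤-reflexive (sym (+-identityʳ d))))) 0<a
  2^d≡1+d : 2 ^ d ≡ suc d
  2^d≡1+d = trans (sym (+-identityʳ (2 ^ d))) (trans (cong (λ m → m * 2 ^ d) (sym a≡1)) (trans eq (cong (_+ d) a≡1)))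

fewer-edges⇒1-vs-2 : ∀ {a b k₁ k₂} → 0 < a → a < b → a + k₁ ≡ b + k₂ → a * 2 ^ k₁ ≡ b * 2 ^ k₂ → a ≡ 1 × b ≡ 2
fewer-edges⇒1-vs-2 {a} {b} {k₁} {k₂} 0<a a<b sums counts = a≡1 , trans (sym a+gap≡b) (cong₂ _+_ a≡1 gap≡1)
  where
  gap = b ∸ a
  a+gap≡b : a + gap ≡ b
  a+gap≡b = m+[n∸m]≡n (<⇒≤ a<b)
  k₁≡gap+k₂ : k₁ ≡ gap + k₂
  k₁≡gap+k₂ = +-cancelˡ-≡ a k₁ (gap + k₂) (trans sums (trans (cong (_+ k₂) (sym a+gap≡b)) (+-assoc a gap k₂)))
  cancelled : (a * 2 ^ gap) * 2 ^ k₂ ≡ (a + gap) * 2 ^ k₂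
  cancelled = begin
    (a * 2 ^ gap) * 2 ^ k₂   ≡⟨ *-assoc a (2 ^ gap) (2 ^ k₂) ⟩
    a * (2 ^ gap * 2 ^ k₂)   ≡⟨ cong (a *_) (^-distribˡ-+-* 2 gap k₂) ⟨
    a * 2 ^ (gap + k₂)       ≡⟨ cong (λ m → a * 2 ^ m) k₁≡gap+k₂ ⟨
    a * 2 ^ k₁               ≡⟨ counts ⟩
    b * 2 ^ k₂               ≡⟨ cong (_* 2 ^ k₂) a+gap≡b ⟨
    (a + gap) * 2 ^ k₂       ∎
    where open ≡-Reasoning
  a≡1×gap≡1 = a*2^d≡a+d⇒ 0<a (m<n⇒0<n∸m a<b) (*-cancelʳ-≡ _ _ (2 ^ k₂) {{>-nonZero (m^n>0 2 k₂)}} cancelled)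
  a≡1 = proj₁ a≡1×gap≡1
  gap≡1 = proj₂ a≡1×gap≡1

components-≡-unless-1-vs-2 : ∀ {a b k₁ k₂} → 0 < a → 0 < b → a + k₁ ≡ b + k₂ → a * 2 ^ k₁ ≡ b * 2 ^ k₂ →
  k₁ ≡ k₂ ⊎ (a ≡ 1 × b ≡ 2) ⊎ (a ≡ 2 × b ≡ 1)
components-≡-unless-1-vs-2 {a} {b} {k₁} {k₂} 0<a 0<b sums counts with <-cmp a b
... | tri< a<b _ _ = inj₂ (inj₁ (fewer-edges⇒1-vs-2 0<a a<b sums counts))
... | tri≈ _ refl _ = inj₁ (+-cancelˡ-≡ a k₁ k₂ sums)
... | tri> _ _ b<a = inj₂ (inj₂ (Product.swap (fewer-edges⇒1-vs-2 0<b b<a (sym sums) (sym counts))))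

homCounts⇒3 : ∀ {N H} → 0 < N → H * N ^ 2 ≡ 2 * N ^ N → H * N ^ 3 ≡ 6 * N ^ N → N ≡ 3
homCounts⇒3 {N} {H} 0<N two six = *-cancelʳ-≡ N 3 2 (*-cancelʳ-≡ (N * 2) 6 (N ^ N) {{>-nonZero (m^n>0 N {{>-nonZero 0<N}} N)}} (begin
  (N * 2) * N ^ N   ≡⟨ *-assoc N 2 (N ^ N) ⟩
  N * (2 * N ^ N)   ≡⟨ cong (N *_) two ⟨
  N * (H * N ^ 2)   ≡⟨ *-exchange N H (N ^ 2) ⟩
  H * N ^ 3         ≡⟨ six ⟩
  6 * N ^ N         ∎))
  where open ≡-Reasoning

homCounts-incompatible : ∀ {N H} → 0 < N → H * N ^ 2 ≡ 2 * N ^ N → H * N ^ 4 ≡ 16 * N ^ N → ⊥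
homCounts-incompatible {N} {H} 0<N two sixteen =
  square≢8 N (*-cancelʳ-≡ (N * N) 8 2 (*-cancelʳ-≡ ((N * N) * 2) 16 (N ^ N) {{>-nonZero (m^n>0 N {{>-nonZero 0<N}} N)}} (begin
  ((N * N) * 2) * N ^ N   ≡⟨ *-assoc (N * N) 2 (N ^ N) ⟩
  (N * N) * (2 * N ^ N)   ≡⟨ cong ((N * N) *_) two ⟨
  (N * N) * (H * N ^ 2)   ≡⟨ *-assoc N N (H * N ^ 2) ⟩
  N * (N * (H * N ^ 2))   ≡⟨ cong (N *_) (*-exchange N H (N ^ 2)) ⟩
  N * (H * N ^ 3)         ≡⟨ *-exchange N H (N ^ 3) ⟩
  H * N ^ 4               ≡⟨ sixteen ⟩
  16 * N ^ N              ∎)))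
  where
  open ≡-Reasoning
  square≢8 : ∀ m → m * m ≢ 8
  square≢8 0 ()
  square≢8 1 ()
  square≢8 2 ()
  square≢8 (suc (suc (suc m))) eq = <-irrefl (sym eq) (*-mono-≤ (s≤s (s≤s (s≤s (z≤n {m})))) (s≤s (s≤s (s≤s (z≤n {m})))))

Fin⇒0< : ∀ {m} → Fin m → 0 < m
Fin⇒0< {suc m} _ = s≤s z≤n

module _ {F₁ F₂ : Graph} (forest₁ : Forest F₁) (forest₂ : Forest F₂) {k₁ k₂ : ℕ}
         (components₁ : HasComponents F₁ k₁) (components₂ : HasComponents F₂ k₂) (X≡ : X F₁ F₁ ≡Sym X F₂ F₂) where

  private
    module F₁ = ForestInvariants F₁ forest₁ components₁
    module F₂ = ForestInvariants F₂ forest₂ components₂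

    N≡ : n F₁ ≡ n F₂
    N≡ = X-≡⇒vertexCount-≡ F₁ F₂ X≡

    in-F₁-terms : ∀ e c → homCount F₂ * n F₂ ^ e ≡ c * n F₂ ^ n F₂ → homCount F₁ * n F₁ ^ e ≡ c * n F₁ ^ n F₁
    in-F₁-terms e c eq = subst (λ N → homCount F₁ * N ^ e ≡ c * N ^ N) (sym N≡)
      (trans (cong (_* n F₂ ^ e) (X-≡⇒selfHomCount-≡ F₁ F₂ X≡ (λ _ → yes tt))) eq)

  edgeless⇒edgeless : n F₁ ∸ k₁ ≡ 0 → n F₂ ∸ k₂ ≡ 0
  edgeless⇒edgeless none₁ with n F₂ ∸ k₂ ≟ 0
  ... | yes none₂ = none₂
  ... | no some₂ = ⊥-elim (<-irrefl (sym (trans same-count (F₂.edge⇒count-imageSize≡1≡0 0<e₂))) (F₁.edgeless⇒count-imageSize≡1>0 none₁ v))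
    where
    0<e₂ = n≢0⇒n>0 some₂
    same-count = X-≡⇒selfHomCount-≡ F₁ F₂ X≡ (λ τ → length τ ≟ 1)
    v = subst Fin (sym N≡) (proj₁ (F₂.nonRoot-exists 0<e₂))

  one-vs-two-edges : n F₁ ∸ k₁ ≡ 1 → n F₂ ∸ k₂ ≡ 2 → F₁ ≅ K1⊔K2 × F₂ ≅ P3
  one-vs-two-edges one two with F₂.twoEdges⇒pathOrMatching two
  ... | inj₁ path = edgeShape⇒≅K1⊔K2 F₁ edge three , pathShape⇒≅P3 F₂ path (trans (sym N≡) three)
    where
    edge = F₁.oneEdge⇒edgeShape one
    three : n F₁ ≡ 3
    three = homCounts⇒3 {n F₁} {homCount F₁} (Fin⇒0< (EdgeShape.w edge)) (edgeShape⇒homCount F₁ edge)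
                        (in-F₁-terms 3 6 (pathShape⇒homCount F₂ path))
  ... | inj₂ matching = ⊥-elim (homCounts-incompatible {n F₁} {homCount F₁} (Fin⇒0< (EdgeShape.w edge)) (edgeShape⇒homCount F₁ edge)
                                                      (in-F₁-terms 4 16 (matchingShape⇒homCount F₂ matching)))
    where
    edge = F₁.oneEdge⇒edgeShape one

  edges+components-≡ : (n F₁ ∸ k₁) + k₁ ≡ (n F₂ ∸ k₂) + k₂
  edges+components-≡ = trans (m∸n+n≡m F₁.k≤n) (trans N≡ (sym (m∸n+n≡m F₂.k≤n)))

  same-edges⇒same-components : n F₁ ∸ k₁ ≡ n F₂ ∸ k₂ → k₁ ≡ k₂
  same-edges⇒same-components e₁≡e₂ = +-cancelˡ-≡ (n F₂ ∸ k₂) k₁ k₂ (trans (cong (_+ k₁) (sym e₁≡e₂)) edges+components-≡)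

  homsOntoEdges-≡ : 0 < n F₁ ∸ k₁ → 0 < n F₂ ∸ k₂ → (n F₁ ∸ k₁) * 2 ^ k₁ ≡ (n F₂ ∸ k₂) * 2 ^ k₂
  homsOntoEdges-≡ some₁ some₂ = begin
    (n F₁ ∸ k₁) * 2 ^ k₁                    ≡⟨ F₁.count-homsOntoEdges some₁ ⟨
    selfHomCount F₁ (λ τ → length τ ≟ 2)    ≡⟨ X-≡⇒selfHomCount-≡ F₁ F₂ X≡ (λ τ → length τ ≟ 2) ⟩
    selfHomCount F₂ (λ τ → length τ ≟ 2)    ≡⟨ F₂.count-homsOntoEdges some₂ ⟩
    (n F₂ ∸ k₂) * 2 ^ k₂                    ∎
    where open ≡-Reasoning

X-≡-sym : ∀ {F₁ F₂} → X F₁ F₁ ≡Sym X F₂ F₂ → X F₂ F₂ ≡Sym X F₁ F₁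
X-≡-sym X≡ τ = sym (X≡ τ)

components-≡-or-1-vs-2-edges : ∀ {F₁ F₂} (forest₁ : Forest F₁) (forest₂ : Forest F₂) {k₁ k₂}
  (components₁ : HasComponents F₁ k₁) (components₂ : HasComponents F₂ k₂) → X F₁ F₁ ≡Sym X F₂ F₂ →
  k₁ ≡ k₂ ⊎ (n F₁ ∸ k₁ ≡ 1 × n F₂ ∸ k₂ ≡ 2) ⊎ (n F₁ ∸ k₁ ≡ 2 × n F₂ ∸ k₂ ≡ 1)
components-≡-or-1-vs-2-edges {F₁} {F₂} fo₁ fo₂ {k₁} {k₂} c₁ c₂ X≡ with n F₁ ∸ k₁ ≟ 0 | n F₂ ∸ k₂ ≟ 0
... | yes none₁ | _ =
  inj₁ (same-edges⇒same-components fo₁ fo₂ c₁ c₂ X≡ (trans none₁ (sym (edgeless⇒edgeless fo₁ fo₂ c₁ c₂ X≡ none₁))))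
... | no _ | yes none₂ =
  inj₁ (same-edges⇒same-components fo₁ fo₂ c₁ c₂ X≡ (trans (edgeless⇒edgeless fo₂ fo₁ c₂ c₁ (X-≡-sym {F₁} {F₂} X≡) none₂) (sym none₂)))
... | no some₁ | no some₂ = components-≡-unless-1-vs-2 (n≢0⇒n>0 some₁) (n≢0⇒n>0 some₂)
  (edges+components-≡ fo₁ fo₂ c₁ c₂ X≡) (homsOntoEdges-≡ fo₁ fo₂ c₁ c₂ X≡ (n≢0⇒n>0 some₁) (n≢0⇒n>0 some₂))

proposition2p27 : (F₁ F₂ : Graph) → Forest F₁ → Forest F₂ →
    X F₁ F₁ ≡Sym X F₂ F₂ →
    ¬ ((F₁ ≅ K1⊔K2 × F₂ ≅ P3) ⊎ (F₁ ≅ P3 × F₂ ≅ K1⊔K2)) →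
    (k₁ k₂ : ℕ) → HasComponents F₁ k₁ → HasComponents F₂ k₂ → k₁ ≡ k₂
proposition2p27 F₁ F₂ forest₁ forest₂ X≡ not-exceptional k₁ k₂ components₁ components₂
  with components-≡-or-1-vs-2-edges forest₁ forest₂ components₁ components₂ X≡
... | inj₁ k₁≡k₂ = k₁≡k₂
... | inj₂ (inj₁ (one , two)) =
  ⊥-elim (not-exceptional (inj₁ (one-vs-two-edges forest₁ forest₂ components₁ components₂ X≡ one two)))
... | inj₂ (inj₂ (two , one)) =
  ⊥-elim (not-exceptional (inj₂ (Product.swap
    (one-vs-two-edges forest₂ forest₁ components₂ components₁ (X-≡-sym {F₁} {F₂} X≡) one two))))
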